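{- (a) The pair $(\mathrm{des},\mathrm{comaj})$ is shuffle-compatible. (b) The linear map on $\mathcal{A}_{(\mathrm{des},\mathrm{comaj})}$ defined by $[\pi]\mapsto q^{\mathrm{comaj}(\pi)}\binom{p-\mathrm{des}(\pi)+|\pi|-1}{|\pi|}_q x^{|\pi|}$ is a $\mathbb{Q}$-algebra isomorphism from $\mathcal{A}_{(\mathrm{des},\mathrm{comaj})}$ to the span of $\{1\}\cup\{q^k\binom{p-j+n-1}{n}_q x^n\}_{n\ge1,\,0\le j\le n-1,\,\binom{j+1}{2}\le k\le nj-\binom{j+1}2}$, a subalgebra of $\mathbb{Q}[q,x]^{\mathbb{N}}$, the algebra (with pointwise operations) of functions $\mathbb{N}\to\mathbb{Q}[q,x]$ of the nonnegative integer variable $p$. (c) The linear map defined by $[\pi]\mapsto \frac{q^{\mathrm{comaj}(\pi)}t^{\mathrm{des}(\pi)+1}}{(1-t)(1-qt)\cdots(1-q^{|\pi|}t)}x^{|\pi|}$ if $|\pi|\ge1$ and $[\pi]\mapsto 1/(1-t)$ if $|\pi|=0$ is a $\mathbb{Q}$-algebra isomorphism from $\mathcal{A}_{(\mathrm{des},\mathrm{comaj})}$ to the span of $\{\frac1{1-t}\}\cup\{\frac{q^kt^{j+1}}{(1-t)(1-qt)\cdots(1-q^nt)}x^n\}_{n\ge1,\,0\le j\le n-1,\,\binom{j+1}2\le k\le nj-\binom{j+1}2}$, a subalgebra of $\mathbb{Q}[[t*,q]][x]$. (d) For $n\ge1$, the $n$th homogeneous component of $\mathcal{A}_{(\mathrm{des},\mathrm{comaj})}$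 has dimension $\binom n3+n$.
   Context: A permutation of length $n$ is a sequence $\pi=\pi_1\cdots\pi_n$ of distinct positive integers. $\mathrm{des}(\pi)$ is the number of $i\in[n-1]$ with $\pi_i>\pi_{i+1}$, and $\mathrm{comaj}(\pi)=\sum_{i:\pi_i>\pi_{i+1}}(n-i)$ (both $0$ for the empty permutation). For disjoint permutations, $S(\pi,\sigma)$ is the set of shuffles (permutations of length $|\pi|+|\sigma|$ containing both as subsequences). A statistic $\mathrm{st}$ is shuffle-compatible if for disjoint $\pi,\sigma$ the multiset $\{\mathrm{st}(\tau):\tau\in S(\pi,\sigma)\}$ depends only on $\mathrm{st}(\pi),\mathrm{st}(\sigma),|\pi|,|\sigma|$; its shuffle algebra $\mathcal{A}_{\mathrm{st}}$ has basis the classes $[\pi]$ of permutations with equal length and $\mathrm{st}$-value, product $[\pi][\sigma]=\sum_{\tau\in S(\pi,\sigma)}[\tau]$, graded by length. $\binom{n}{k}_q$ is the $q$-binomial coefficient $[n]_q!/([k]_q![n-k]_q!)$ with $[n]_q!=\prod_{i=1}^n(1+q+\cdots+q^{i-1})$ (and it is $0$ when $0\le n<k$). $\mathbb{Q}[[t*,q]][x]$ denotes polynomials in $x$ with coefficients in formal power series in $t,q$, where multiplication is ordinary in $x$ and $q$ but is the Hadamard product in $t$: $(\sum_n a_nt^n)*(\sum_n b_nt^n)=\sum_n a_nb_nt^n$. -}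

module Defs where

open import Data.Nat as ℕ using (ℕ; zero; suc; _∸_; _≤_; _<ᵇ_; _≡ᵇ_; _≤ᵇ_)
open import Data.Nat.Combinatorics using (_C_)
open import Data.Bool using (Bool; true; false; if_then_else_; _∧_)
open import Data.List using (List; []; _∷_; _++_; length; map; foldr; filter; concatMap; upTo)
open import Data.Nat.ListAction using (sum)
open import Data.List.Relation.Unary.All using (All)
open import Data.List.Relation.Unary.AllPairs using (AllPairs)
open import Data.List.Relation.Binary.Permutation.Propositional using (_↭_)
open import Data.List.Membership.Propositional using (_∈_; _∉_)
open import Data.List.Relation.Unary.Unique.Propositional using (Unique)
open import Data.Rational as ℚ using (ℚ; 0ℚ; 1ℚ)
open import Data.Product using (Σ; _×_; _,_; proj₁; proj₂)
open import Data.Sum using (_⊎_)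
open import Function using (_∘_; _⇔_)
open import Relation.Nullary.Decidable using (⌊_⌋)
open import Relation.Binary.PropositionalEquality using (_≡_; _≢_)
open import Data.List.Relation.Binary.Sublist.DecPropositional ℕ._≟_ using (_⊆?_)
open import Data.Integer using (+_)

IsPerm : List ℕ → Set
IsPerm π = AllPairs _≢_ π × All (λ x → 0 ℕ.< x) π

Disjoint : List ℕ → List ℕ → Set
Disjoint π σ = All (λ x → x ∉ σ) π

descentsFrom : ℕ → List ℕ → List ℕ
descentsFrom i []            = []
descentsFrom i (x ∷ [])      = []
descentsFrom i (x ∷ y ∷ ys)  =
  if y <ᵇ x then i ∷ descentsFrom (suc i) (y ∷ ys)
            else descentsFrom (suc i) (y ∷ ys)

descents : List ℕ → List ℕ
descents = descentsFrom 1

des : List ℕ → ℕ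
des π = length (descents π)

comaj : List ℕ → ℕ
comaj π = sum (map (λ i → length π ∸ i) (descents π))

st : List ℕ → ℕ × ℕ
st π = des π , comaj π

-- Shuffle set S(π,σ): all rearrangements of π ++ σ containing both
-- π and σ as subsequences (any permutation of length |π|+|σ| containing
-- both uses exactly the letters of π ++ σ).

insertEverywhere : ℕ → List ℕ → List (List ℕ)
insertEverywhere x []       = (x ∷ []) ∷ []
insertEverywhere x (y ∷ ys) = (x ∷ y ∷ ys) ∷ map (y ∷_) (insertEverywhere x ys)

rearrangements : List ℕ → List (List ℕ)
rearrangements []       = [] ∷ []
rearrangements (x ∷ xs) = concatMap (insertEverywhere x) (rearrangements xs)

shuffles : List ℕ → List ℕ → List (List ℕ)
shuffles π σ =
  filter (λ τ → π ⊆? τ) (filter (λ τ → σ ⊆? τ) (rearrangements (π ++ σ)))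

ShuffleCompatible : Set
ShuffleCompatible =
  ∀ (π σ π′ σ′ : List ℕ) → IsPerm π → IsPerm σ → IsPerm π′ → IsPerm σ′ →
  Disjoint π σ → Disjoint π′ σ′ →
  length π ≡ length π′ → length σ ≡ length σ′ → st π ≡ st π′ → st σ ≡ st σ′ →
  map st (shuffles π σ) ↭ map st (shuffles π′ σ′)

-- Basis classes of A_(des,comaj): triples (n, d, c) realised by some permutation

Idx : Set
Idx = ℕ × ℕ × ℕ

Achieved : Idx → Set
Achieved (n , d , c) =
  Σ (List ℕ) λ π → IsPerm π × length π ≡ n × des π ≡ d × comaj π ≡ c

cls : List ℕ → Idx
cls π = length π , des π , comaj π

-- index set of the target spanning family (n = 0 stands for the element 1)
Target : Idx → Set
Target (n , j , k) =
  (n ≡ 0 × j ≡ 0 × k ≡ 0) ⊎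
  (1 ≤ n × j ≤ n ∸ 1 × (suc j C 2) ≤ k × k ≤ n ℕ.* j ∸ (suc j C 2))

-- Coefficient arrays ℕ → ℕ → ℕ → ℚ.
-- For (b): E f p a b = coefficient of q^a x^b in f(p)   (f : ℕ → ℚ[q,x]).
-- For (c): E f m a b = coefficient of t^m q^a x^b.
-- Equality is coefficientwise.

E : Set
E = ℕ → ℕ → ℕ → ℚ

_≈_ : E → E → Set
f ≈ g = ∀ m a b → f m a b ≡ g m a b

fromℕ : ℕ → ℚ
fromℕ n = (+ n) ℚ./ 1

Σ≤ : ℕ → (ℕ → ℚ) → ℚ
Σ≤ n f = foldr ℚ._+_ 0ℚ (map f (upTo (suc n)))

0E : E
0E _ _ _ = 0ℚ

_⊕_ : E → E → E
(f ⊕ g) m a b = f m a b ℚ.+ g m a b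

_·_ : ℚ → E → E
(c · f) m a b = c ℚ.* f m a b

lincomb : List (ℚ × E) → E
lincomb = foldr (λ cf acc → (proj₁ cf · proj₂ cf) ⊕ acc) 0E

sumE : List E → E
sumE = foldr _⊕_ 0E

-- Product: pointwise in the first index (pointwise product of functions of
-- p for (b); Hadamard product in t for (c)); ordinary (Cauchy) product in
-- the variables q and x.
_⊛_ : E → E → E
(f ⊛ g) m a b = Σ≤ a λ i → Σ≤ b λ j → f m i j ℚ.* g m (a ∸ i) (b ∸ j)

-- Abstract statement of "the linear map [π] ↦ φ(cls π) is a Q-algebra
-- isomorphism from A_(des,comaj) onto span{ gen i : Target i }, which is a
-- subalgebra (with unit one)".

InSpan : (Idx → Set) → (Idx → E) → E → Set
InSpan P g f =
  Σ (List (ℚ × Idx)) λ l →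
    All (P ∘ proj₂) l × (f ≈ lincomb (map (λ ci → proj₁ ci , g (proj₂ ci)) l))

IsAlgIsoOnto : (one : E) → (φ : Idx → E) → (gen : Idx → E) → Set
IsAlgIsoOnto one φ gen =
  (φ (0 , 0 , 0) ≈ one) ×
  (∀ (π σ : List ℕ) → IsPerm π → IsPerm σ → Disjoint π σ →
     (φ (cls π) ⊛ φ (cls σ)) ≈ sumE (map (φ ∘ cls) (shuffles π σ))) ×
  -- injective: images of distinct basis classes are linearly independent
  (∀ (l : List (ℚ × Idx)) → All (Achieved ∘ proj₂) l →
     AllPairs _≢_ (map proj₂ l) →
     lincomb (map (λ ci → proj₁ ci , φ (proj₂ ci)) l) ≈ 0E →
     All (λ ci → proj₁ ci ≡ 0ℚ) l) ×
  -- image = span of the target family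
  (∀ i → Achieved i → InSpan Target gen (φ i)) ×
  (∀ i → Target i → InSpan Achieved φ (gen i)) ×
  -- the span is a subalgebra
  InSpan Target gen one ×
  (∀ f g → InSpan Target gen f → InSpan Target gen g →
     InSpan Target gen (f ⊛ g))

-- Gaussian coefficient binom(n,k)_q as a coefficient sequence in q,
-- via q-Pascal: binom(n+1,k+1) = binom(n,k) + q^(k+1) binom(n,k+1);
-- binom(n,0)=1, binom(0,k+1)=0.
qbin : ℕ → ℕ → ℕ → ℕ
qbin zero    zero    a = if a ≡ᵇ 0 then 1 else 0
qbin zero    (suc k) a = 0
qbin (suc n) zero    a = if a ≡ᵇ 0 then 1 else 0
qbin (suc n) (suc k) a =
  qbin n k a ℕ.+ (if suc k ≤ᵇ a then qbin n (suc k) (a ∸ suc k) else 0)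

monoB : ℕ → ℕ → E
monoB k n _ a b = if (a ≡ᵇ k) ∧ (b ≡ᵇ n) then 1ℚ else 0ℚ

-- p ↦ binom(p - j + n - 1, n)_q   (ℕ-subtraction; exact when n ≥ 1, j ≤ n-1)
qbinB : ℕ → ℕ → E
qbinB n j p a b = if b ≡ᵇ 0 then fromℕ (qbin (p ℕ.+ n ∸ 1 ∸ j) n a) else 0ℚ

oneB : E
oneB = monoB 0 0

φB : Idx → E
φB (n , d , c) = (monoB c 0 ⊛ qbinB n d) ⊛ monoB 0 n

genB : Idx → E
genB (zero    , j , k) = oneB
genB (suc n   , j , k) = φB (suc n , j , k)

S2 : Set                  -- ordinary power series in t, q
S2 = ℕ → ℕ → ℚ

_⊙_ : S2 → S2 → S2
(f ⊙ g) m a = Σ≤ m λ i → Σ≤ a λ j → f i j ℚ.* g (m ∸ i) (a ∸ j)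

monoS : ℕ → ℕ → S2
monoS m k m′ a = if (m′ ≡ᵇ m) ∧ (a ≡ᵇ k) then 1ℚ else 0ℚ

-- 1/(1 - q^i t) = Σ_m q^(i m) t^m
geom : ℕ → S2
geom i m a = if a ≡ᵇ i ℕ.* m then 1ℚ else 0ℚ

-- 1/((1-t)(1-qt)...(1-q^n t))
prodGeom : ℕ → S2
prodGeom zero    = geom 0
prodGeom (suc n) = prodGeom n ⊙ geom (suc n)

liftX : ℕ → S2 → E
liftX n s m a b = if b ≡ᵇ n then s m a else 0ℚ

oneC : E                  -- 1/(1-t), the unit of Q[[t*,q]][x]
oneC = liftX 0 (geom 0)

φC : Idx → E
φC (zero  , d , c) = oneC
φC (suc n , d , c) = liftX (suc n) (monoS (suc d) c ⊙ prodGeom (suc n))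

genC : Idx → E
genC = φC

DimComponent : ℕ → ℕ → Set
DimComponent n r =
  Σ (List (ℕ × ℕ)) λ L → Unique L × length L ≡ r ×
    (∀ d c → ((d , c) ∈ L) ⇔ Achieved (n , d , c))

-- The proof follows Stanley's theory of P-partitions.  For a word w and a
-- bound P let G_P(w) be the multiset of sizes of the w-partitions with parts
-- in [0, P] (weakly increasing, strictly at the descents of w).
--   * Closed form: the generating function of G_P(w) is
--     q^comaj(w) binom(P - des(w) + |w| - 1, |w|)_q, i.e. φB[w] evaluated at
--     p = P (PPartitions, via the q-hockey-stick identity of GaussianMultisets).
--   * Fundamental lemma: for disjoint π, σ the product G_P(π) ⊗ G_P(σ) is a
--     rearrangement of the union of the G_P(τ) over the interleavings τ of π
--     and σ (FundamentalLemma); the interleavings are exactly the shuffle set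
--     S(π, σ) (ShuffleSets).  So φB is multiplicative (ModelB).
--   * Independence: evaluated at p = J + 1 the images φB(n, j, k) with j > J
--     vanish and those with j = J are the monomials q^k x^n, so distinct
--     classes have linearly independent images (Independence).  With
--     multiplicativity this gives shuffle-compatibility (PartA).
--   * The classes are exactly the triples (n, j, k) with j < n and
--     C(j+1,2) ≤ k ≤ nj - C(j+1,2) (DescentComajRange); a generic criterion
--     (IsomorphismCriterion) then yields (b) (PartB).  The coefficient of t^m
--     in φC is φB evaluated at p = m (GeometricSeries), so (c) follows from
--     (b) (PartC), and counting the triples gives (d) (PartD).
module Submission where

open import Defs
open import Data.Nat as ℕ using (ℕ; zero; suc; _+_; _∸_; _≤_; _<_; z≤n; s≤s; _≡ᵇ_; _≤ᵇ_; _<ᵇ_)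
import Data.Nat.Properties as ℕP
open import Data.Nat.Combinatorics using (_C_; nCk+nC[k+1]≡[n+1]C[k+1]; nC1≡n)
open import Data.Nat.ListAction using (sum)
import Data.Nat.ListAction.Properties as SumP
import Data.Nat.GCD as ℕG
open import Data.Nat.Solver using () renaming (module +-*-Solver to ℕ-Solver)
import Data.Integer as ℤ
import Data.Integer.Properties as ℤP
open import Data.Rational as ℚ using (ℚ; 0ℚ; 1ℚ; ↥_; ↧_)
import Data.Rational.Properties as ℚP
import Data.Rational.Unnormalised as ℚᵘ
import Data.Rational.Unnormalised.Properties as ℚᵘP
open import Data.Rational.Solver using () renaming (module +-*-Solver to ℚ-Solver)
open import Data.Bool using (Bool; true; false; if_then_else_)
open import Data.Maybe using (Maybe; just; nothing)
open import Data.Product using (Σ; ∃; _×_; _,_; proj₁; proj₂)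
import Data.Product.Properties as ProdP
open import Data.Sum using (_⊎_; inj₁; inj₂)
open import Data.Empty using (⊥; ⊥-elim)
open import Data.List using (List; []; _∷_; _++_; _∷ʳ_; map; foldr; length; upTo; concat; concatMap)
import Data.List.Properties as LP
open import Data.List.Relation.Unary.All as All using (All; []; _∷_)
import Data.List.Relation.Unary.All.Properties as AllP
open import Data.List.Relation.Unary.AllPairs as AllPairs using (AllPairs; []; _∷_)
import Data.List.Relation.Unary.AllPairs.Properties as AllPairsP
open import Data.List.Relation.Unary.Any using (here; there)
open import Data.List.Membership.Propositional using (_∈_; _∉_)
import Data.List.Membership.Propositional.Properties as MP
open import Data.List.Relation.Unary.Unique.Propositional using (Unique)
import Data.List.Relation.Unary.Unique.Propositional.Properties as UP
open import Data.List.Relation.Binary.Permutation.Propositional using (_↭_; ↭-refl; ↭-reflexive; ↭-sym; ↭-trans; prep; swap) renaming (refl to prefl; trans to ptrans)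
import Data.List.Relation.Binary.Permutation.Propositional.Properties as PP
open import Data.List.Relation.Binary.Sublist.Propositional using (_⊆_; []; _∷_; ⊆-refl; minimum) renaming (_∷ʳ_ to _∷ˢ_; lookup to ⊆-lookup)
open import Data.List.Membership.Propositional.Properties.WithK using (unique∧set⇒bag)
open import Data.List.Relation.Binary.BagAndSetEquality using (∼bag⇒↭)
open import Data.List.Relation.Binary.Sublist.DecPropositional ℕ._≟_ using (_⊆?_)
open import Relation.Binary.PropositionalEquality
open import Relation.Binary.Definitions using (DecidableEquality; tri<; tri≈; tri>)
open import Relation.Nullary using (¬_; Dec; yes; no)
open import Relation.Nullary.Decidable using (⌊_⌋)
open import Relation.Nullary.Reflects using (Reflects; ofʸ; ofⁿ; fromEquivalence)
open import Function using (_∘_; mk⇔)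

module NatToRational where

  open ℤ using (+_)

  ↥fromℕ : ∀ n → ↥ (fromℕ n) ≡ + n
  ↥fromℕ n = trans (sym (ℤP.*-identityʳ _)) (trans (cong (λ g → ↥ (fromℕ n) ℤ.* g) (sym (cong +_ (ℕG.gcd-zeroʳ n)))) (ℚP.↥-/ (+ n) 1))

  ↧fromℕ : ∀ n → ↧ (fromℕ n) ≡ + 1
  ↧fromℕ n = trans (sym (ℤP.*-identityʳ _)) (trans (cong (λ g → ↧ (fromℕ n) ℤ.* g) (sym (cong +_ (ℕG.gcd-zeroʳ n)))) (ℚP.↧-/ (+ n) 1))

  toℚᵘ-fromℕ : ∀ n → ℚ.toℚᵘ (fromℕ n) ℚᵘ.≃ ℚᵘ.mkℚᵘ (+ n) 0
  toℚᵘ-fromℕ n with fromℕ n | ↥fromℕ n | ↧fromℕ n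
  ... | ℚ.mkℚ a d c | p | q = ℚᵘ.*≡* (trans (cong (ℤ._* + 1) p) (cong (+ n ℤ.*_) (sym q)))

  fromℕ-+ : ∀ m n → fromℕ (m ℕ.+ n) ≡ fromℕ m ℚ.+ fromℕ n
  fromℕ-+ m n = ℚP.toℚᵘ-injective (ℚᵘP.≃-trans (toℚᵘ-fromℕ (m ℕ.+ n)) (ℚᵘP.≃-sym (ℚᵘP.≃-trans (ℚP.toℚᵘ-homo-+ (fromℕ m) (fromℕ n))
     (ℚᵘP.≃-trans (ℚᵘP.+-cong (toℚᵘ-fromℕ m) (toℚᵘ-fromℕ n)) (ℚᵘ.*≡* (cong (λ x → x ℤ.* + 1) (cong₂ ℤ._+_ (ℤP.*-identityʳ (+ m)) (ℤP.*-identityʳ (+ n)))))))))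

  -- numerators are preserved, so fromℕ is injective
  fromℕ-inj : ∀ m n → fromℕ m ≡ fromℕ n → m ≡ n
  fromℕ-inj m n e = cong ℤ.∣_∣ (trans (sym (↥fromℕ m)) (trans (cong ↥_ e) (↥fromℕ n)))

  fromℕ-if : ∀ b → fromℕ (if b then 1 else 0) ≡ (if b then 1ℚ else 0ℚ)
  fromℕ-if true = refl
  fromℕ-if false = refl

module BooleanTests where

  private
    reflects-true : ∀ {P : Set} {b} → Reflects P b → P → b ≡ true
    reflects-true (ofʸ _) _ = refl
    reflects-true (ofⁿ ¬p) p = ⊥-elim (¬p p)

    reflects-false : ∀ {P : Set} {b} → Reflects P b → ¬ P → b ≡ false
    reflects-false (ofʸ p) ¬p = ⊥-elim (¬p p)
    reflects-false (ofⁿ _) _ = refl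

    reflects-sound : ∀ {P : Set} {b} → Reflects P b → b ≡ true → P
    reflects-sound (ofʸ p) _ = p

    reflects-refute : ∀ {P : Set} {b} → Reflects P b → b ≡ false → ¬ P
    reflects-refute (ofⁿ ¬p) _ = ¬p

    ≡ᵇ-reflects : ∀ m n → Reflects (m ≡ n) (m ≡ᵇ n)
    ≡ᵇ-reflects m n = fromEquivalence (ℕP.≡ᵇ⇒≡ m n) (ℕP.≡⇒≡ᵇ m n)

  if-true : ∀ {A : Set} {b} {x y : A} → b ≡ true → (if b then x else y) ≡ x
  if-true refl = refl

  if-false : ∀ {A : Set} {b} {x y : A} → b ≡ false → (if b then x else y) ≡ y
  if-false refl = refl

  ≡ᵇ-true : ∀ m n → m ≡ n → (m ≡ᵇ n) ≡ true
  ≡ᵇ-true m n = reflects-true (≡ᵇ-reflects m n)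

  ≡ᵇ-false : ∀ m n → ¬ m ≡ n → (m ≡ᵇ n) ≡ false
  ≡ᵇ-false m n = reflects-false (≡ᵇ-reflects m n)

  ≡ᵇ-sound : ∀ m n → (m ≡ᵇ n) ≡ true → m ≡ n
  ≡ᵇ-sound m n = reflects-sound (≡ᵇ-reflects m n)

  ≤ᵇ-true : ∀ m n → m ≤ n → (m ≤ᵇ n) ≡ true
  ≤ᵇ-true m n = reflects-true (ℕP.≤ᵇ-reflects-≤ m n)

  ≤ᵇ-false : ∀ m n → ¬ m ≤ n → (m ≤ᵇ n) ≡ false
  ≤ᵇ-false m n = reflects-false (ℕP.≤ᵇ-reflects-≤ m n)

  ≤ᵇ-sound : ∀ m n → (m ≤ᵇ n) ≡ true → m ≤ n
  ≤ᵇ-sound m n = reflects-sound (ℕP.≤ᵇ-reflects-≤ m n)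

  ≤ᵇ-refute : ∀ m n → (m ≤ᵇ n) ≡ false → ¬ m ≤ n
  ≤ᵇ-refute m n = reflects-refute (ℕP.≤ᵇ-reflects-≤ m n)

  <ᵇ-true : ∀ m n → m < n → (m <ᵇ n) ≡ true
  <ᵇ-true m n = reflects-true (ℕP.<ᵇ-reflects-< m n)

  <ᵇ-false : ∀ m n → ¬ m < n → (m <ᵇ n) ≡ false
  <ᵇ-false m n = reflects-false (ℕP.<ᵇ-reflects-< m n)

  <ᵇ-sound : ∀ m n → (m <ᵇ n) ≡ true → m < n
  <ᵇ-sound m n = reflects-sound (ℕP.<ᵇ-reflects-< m n)

  <ᵇ-refute : ∀ m n → (m <ᵇ n) ≡ false → ¬ m < n
  <ᵇ-refute m n = reflects-refute (ℕP.<ᵇ-reflects-< m n)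

module FiniteSums where

  open ℚ-Solver using (solve; _:+_; _:=_)

  SL : List ℕ → (ℕ → ℚ) → ℚ
  SL l f = foldr ℚ._+_ 0ℚ (map f l)

  SL-++ : ∀ l₁ l₂ f → SL (l₁ ++ l₂) f ≡ SL l₁ f ℚ.+ SL l₂ f
  SL-++ [] l₂ f = sym (ℚP.+-identityˡ _)
  SL-++ (x ∷ l₁) l₂ f = trans (cong (f x ℚ.+_) (SL-++ l₁ l₂ f)) (sym (ℚP.+-assoc (f x) _ _))

  Σ-zero : ∀ f → Σ≤ 0 f ≡ f 0
  Σ-zero f = ℚP.+-identityʳ (f 0)

  Σ-last : ∀ n f → Σ≤ (suc n) f ≡ Σ≤ n f ℚ.+ f (suc n)
  Σ-last n f = trans (cong (λ l → SL l f) (sym (LP.upTo-∷ʳ (suc n))))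
     (trans (SL-++ (upTo (suc n)) (suc n ∷ []) f) (cong (Σ≤ n f ℚ.+_) (ℚP.+-identityʳ _)))

  Σ-first : ∀ n f → Σ≤ (suc n) f ≡ f 0 ℚ.+ Σ≤ n (λ i → f (suc i))
  Σ-first n f = cong (λ l → f 0 ℚ.+ foldr ℚ._+_ 0ℚ l)
     (trans (cong (map f) (sym (LP.map-upTo suc (suc n)))) (sym (LP.map-∘ (upTo (suc n)))))

  Σ-cong : ∀ n {f g} → (∀ i → i ≤ n → f i ≡ g i) → Σ≤ n f ≡ Σ≤ n g
  Σ-cong zero {f} {g} h = trans (Σ-zero f) (trans (h 0 z≤n) (sym (Σ-zero g)))
  Σ-cong (suc n) {f} {g} h = trans (Σ-last n f) (trans (cong₂ ℚ._+_ (Σ-cong n (λ i i≤n → h i (ℕP.m≤n⇒m≤1+n i≤n))) (h (suc n) ℕP.≤-refl)) (sym (Σ-last n g)))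

  Σ-+ : ∀ n f g → Σ≤ n (λ i → f i ℚ.+ g i) ≡ Σ≤ n f ℚ.+ Σ≤ n g
  Σ-+ zero f g = trans (Σ-zero (λ i → f i ℚ.+ g i)) (sym (cong₂ ℚ._+_ (Σ-zero f) (Σ-zero g)))
  Σ-+ (suc n) f g = trans (Σ-last n (λ i → f i ℚ.+ g i)) (trans (cong (ℚ._+ (f (suc n) ℚ.+ g (suc n))) (Σ-+ n f g))
     (trans (interchange (Σ≤ n f) (Σ≤ n g) (f (suc n)) (g (suc n))) (sym (cong₂ ℚ._+_ (Σ-last n f) (Σ-last n g)))))
    where
    interchange : ∀ a b c d → (a ℚ.+ b) ℚ.+ (c ℚ.+ d) ≡ (a ℚ.+ c) ℚ.+ (b ℚ.+ d)
    interchange = solve 4 (λ a b c d → (a :+ b) :+ (c :+ d) := (a :+ c) :+ (b :+ d)) refl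

  Σ-*ˡ : ∀ n c f → c ℚ.* Σ≤ n f ≡ Σ≤ n (λ i → c ℚ.* f i)
  Σ-*ˡ zero c f = trans (cong (c ℚ.*_) (Σ-zero f)) (sym (Σ-zero (λ i → c ℚ.* f i)))
  Σ-*ˡ (suc n) c f = trans (cong (c ℚ.*_) (Σ-last n f)) (trans (ℚP.*-distribˡ-+ c _ _)
     (trans (cong (ℚ._+ (c ℚ.* f (suc n))) (Σ-*ˡ n c f)) (sym (Σ-last n (λ i → c ℚ.* f i)))))

  Σ-0 : ∀ n f → (∀ i → i ≤ n → f i ≡ 0ℚ) → Σ≤ n f ≡ 0ℚ
  Σ-0 zero f h = trans (Σ-zero f) (h 0 z≤n)
  Σ-0 (suc n) f h = trans (Σ-last n f) (trans (cong₂ ℚ._+_ (Σ-0 n f (λ i i≤n → h i (ℕP.m≤n⇒m≤1+n i≤n))) (h (suc n) ℕP.≤-refl)) (ℚP.+-identityʳ 0ℚ))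

  Σ-single : ∀ n k f → k ≤ n → (∀ i → i ≤ n → ¬ i ≡ k → f i ≡ 0ℚ) → Σ≤ n f ≡ f k
  Σ-single zero .zero f z≤n h = Σ-zero f
  Σ-single (suc n) k f k≤ h with k ℕP.≟ suc n
  ... | yes refl = trans (Σ-last n f) (trans (cong (ℚ._+ f (suc n)) (Σ-0 n f (λ i i≤n → h i (ℕP.m≤n⇒m≤1+n i≤n) (λ e → ℕP.<-irrefl e (s≤s i≤n))))) (ℚP.+-identityˡ _))
  ... | no k≢ = trans (Σ-last n f) (trans (cong (Σ≤ n f ℚ.+_) (h (suc n) ℕP.≤-refl (λ e → k≢ (sym e)))) (trans (ℚP.+-identityʳ _)
       (Σ-single n k f (ℕP.≤-pred (ℕP.≤∧≢⇒< k≤ k≢)) (λ i i≤n → h i (ℕP.m≤n⇒m≤1+n i≤n)))))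

  Σ-rev : ∀ n f → Σ≤ n f ≡ Σ≤ n (λ i → f (n ∸ i))
  Σ-rev zero f = refl
  Σ-rev (suc n) f = trans (Σ-last n f) (trans (cong (ℚ._+ f (suc n)) (Σ-rev n f))
     (trans (ℚP.+-comm (Σ≤ n (λ i → f (n ∸ i))) (f (suc n))) (sym (Σ-first n (λ i → f (suc n ∸ i))))))

module CoefficientArrays where

  open FiniteSums
  open BooleanTests

  ≈-refl : ∀ {f} → f ≈ f
  ≈-refl m a b = refl

  ≈-sym : ∀ {f g} → f ≈ g → g ≈ f
  ≈-sym e m a b = sym (e m a b)

  ≈-trans : ∀ {f g h} → f ≈ g → g ≈ h → f ≈ h
  ≈-trans e e′ m a b = trans (e m a b) (e′ m a b)

  ⊛-cong : ∀ {f f′ g g′} → f ≈ f′ → g ≈ g′ → (f ⊛ g) ≈ (f′ ⊛ g′)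
  ⊛-cong ff gg m a b =
    Σ-cong a (λ i _ → Σ-cong b (λ j _ → cong₂ ℚ._*_ (ff m i j) (gg m (a ∸ i) (b ∸ j))))

  ⊛-distribʳ : ∀ f g h → ((f ⊕ g) ⊛ h) ≈ ((f ⊛ h) ⊕ (g ⊛ h))
  ⊛-distribʳ f g h m a b =
    trans (Σ-cong a (λ i _ → trans (Σ-cong b (λ j _ → ℚP.*-distribʳ-+ (h m (a ∸ i) (b ∸ j)) (f m i j) (g m i j)))
                                   (Σ-+ b (λ j → f m i j ℚ.* h m (a ∸ i) (b ∸ j)) (λ j → g m i j ℚ.* h m (a ∸ i) (b ∸ j)))))
          (Σ-+ a (λ i → Σ≤ b (λ j → f m i j ℚ.* h m (a ∸ i) (b ∸ j))) (λ i → Σ≤ b (λ j → g m i j ℚ.* h m (a ∸ i) (b ∸ j))))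

  ⊛-distribˡ : ∀ f g h → (h ⊛ (f ⊕ g)) ≈ ((h ⊛ f) ⊕ (h ⊛ g))
  ⊛-distribˡ f g h m a b =
    trans (Σ-cong a (λ i _ → trans (Σ-cong b (λ j _ → ℚP.*-distribˡ-+ (h m i j) (f m (a ∸ i) (b ∸ j)) (g m (a ∸ i) (b ∸ j))))
                                   (Σ-+ b (λ j → h m i j ℚ.* f m (a ∸ i) (b ∸ j)) (λ j → h m i j ℚ.* g m (a ∸ i) (b ∸ j)))))
          (Σ-+ a (λ i → Σ≤ b (λ j → h m i j ℚ.* f m (a ∸ i) (b ∸ j))) (λ i → Σ≤ b (λ j → h m i j ℚ.* g m (a ∸ i) (b ∸ j))))

  ·-⊛ : ∀ c f h → ((c · f) ⊛ h) ≈ (c · (f ⊛ h))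
  ·-⊛ c f h m a b = sym (trans (Σ-*ˡ a c (λ i → Σ≤ b (λ j → f m i j ℚ.* h m (a ∸ i) (b ∸ j))))
     (Σ-cong a (λ i _ → trans (Σ-*ˡ b c (λ j → f m i j ℚ.* h m (a ∸ i) (b ∸ j)))
     (Σ-cong b (λ j _ → sym (ℚP.*-assoc c (f m i j) (h m (a ∸ i) (b ∸ j))))))))

  ⊛-· : ∀ c f h → (h ⊛ (c · f)) ≈ (c · (h ⊛ f))
  ⊛-· c f h m a b = sym (trans (Σ-*ˡ a c (λ i → Σ≤ b (λ j → h m i j ℚ.* f m (a ∸ i) (b ∸ j))))
     (Σ-cong a (λ i _ → trans (Σ-*ˡ b c (λ j → h m i j ℚ.* f m (a ∸ i) (b ∸ j)))
     (Σ-cong b (λ j _ → trans (sym (ℚP.*-assoc c (h m i j) (f m (a ∸ i) (b ∸ j))))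
        (trans (cong (ℚ._* f m (a ∸ i) (b ∸ j)) (ℚP.*-comm c (h m i j))) (ℚP.*-assoc (h m i j) c (f m (a ∸ i) (b ∸ j)))))))))

  ⊛-zeroˡ : ∀ h → (0E ⊛ h) ≈ 0E
  ⊛-zeroˡ h m a b = Σ-0 a _ (λ i _ → Σ-0 b _ (λ j _ → ℚP.*-zeroˡ (h m (a ∸ i) (b ∸ j))))

  ⊛-zeroʳ : ∀ h → (h ⊛ 0E) ≈ 0E
  ⊛-zeroʳ h m a b = Σ-0 a _ (λ i _ → Σ-0 b _ (λ j _ → ℚP.*-zeroʳ (h m i j)))

  sumE-cong : ∀ {A : Set} (F F′ : A → E) l → All (λ z → F z ≈ F′ z) l → sumE (map F l) ≈ sumE (map F′ l)
  sumE-cong F F′ [] _ = ≈-refl {0E}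
  sumE-cong F F′ (z ∷ l) (e ∷ es) m a b = cong₂ ℚ._+_ (e m a b) (sumE-cong F F′ l es m a b)

  sumE-↭ : ∀ {A : Set} (F : A → E) {l l′} → l ↭ l′ → sumE (map F l) ≈ sumE (map F l′)
  sumE-↭ F prefl = ≈-refl
  sumE-↭ F (prep x p) m a b = cong (F x m a b ℚ.+_) (sumE-↭ F p m a b)
  sumE-↭ F (swap x y p) m a b = trans (sym (ℚP.+-assoc (F x m a b) _ _)) (trans (cong (ℚ._+ _) (ℚP.+-comm (F x m a b) (F y m a b)))
     (trans (ℚP.+-assoc (F y m a b) _ _) (cong (λ z → F y m a b ℚ.+ (F x m a b ℚ.+ z)) (sumE-↭ F p m a b))))
  sumE-↭ F (ptrans p q) = ≈-trans (sumE-↭ F p) (sumE-↭ F q)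

  _≈S_ : S2 → S2 → Set
  u ≈S v = ∀ m a → u m a ≡ v m a

  _⋆_ : S2 → S2 → S2
  (u ⋆ v) m a = Σ≤ a (λ i → u m i ℚ.* v m (a ∸ i))

  liftX-cong : ∀ n {u v} → u ≈S v → liftX n u ≈ liftX n v
  liftX-cong n e m a b with b ≡ᵇ n
  ... | true = e m a
  ... | false = refl

  liftX-⊕ : ∀ n u v → (liftX n u ⊕ liftX n v) ≈ liftX n (λ m a → u m a ℚ.+ v m a)
  liftX-⊕ n u v m a b with b ≡ᵇ n
  ... | true = refl
  ... | false = ℚP.+-identityˡ 0ℚ

  liftX-⊛ : ∀ n₁ n₂ u v → (liftX n₁ u ⊛ liftX n₂ v) ≈ liftX (n₁ + n₂) (u ⋆ v)
  liftX-⊛ n₁ n₂ u v m a b with b ℕP.≟ n₁ + n₂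
  ... | yes refl = trans (Σ-cong a (λ i _ → inner i)) (sym (if-true (≡ᵇ-true (n₁ + n₂) (n₁ + n₂) refl)))
    where
    -- only the term x^n₁ · x^n₂ contributes to the coefficient of x^(n₁+n₂)
    inner : ∀ i → Σ≤ (n₁ + n₂) (λ j → liftX n₁ u m i j ℚ.* liftX n₂ v m (a ∸ i) (n₁ + n₂ ∸ j)) ≡ u m i ℚ.* v m (a ∸ i)
    inner i = trans (Σ-single (n₁ + n₂) n₁ _ (ℕP.m≤m+n n₁ n₂) (λ j _ j≢ → trans (cong (ℚ._* Y j) (if-false (≡ᵇ-false j n₁ j≢))) (ℚP.*-zeroˡ (Y j))))
                    (cong₂ ℚ._*_ (if-true (≡ᵇ-true n₁ n₁ refl)) (if-true (≡ᵇ-true (n₁ + n₂ ∸ n₁) n₂ (ℕP.m+n∸m≡n n₁ n₂))))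
      where
      Y : ℕ → ℚ
      Y j = liftX n₂ v m (a ∸ i) (n₁ + n₂ ∸ j)
  ... | no b≢ = trans (Σ-0 a _ (λ i _ → Σ-0 b _ (λ j j≤b → vanish i j j≤b))) (sym (if-false (≡ᵇ-false b (n₁ + n₂) b≢)))
    where
    -- no pair of degrees n₁, n₂ adds up to b
    vanish : ∀ i j → j ≤ b → liftX n₁ u m i j ℚ.* liftX n₂ v m (a ∸ i) (b ∸ j) ≡ 0ℚ
    vanish i j j≤b with j ℕP.≟ n₁ | b ∸ j ℕP.≟ n₂
    ... | no j≢ | _ = trans (cong (ℚ._* liftX n₂ v m (a ∸ i) (b ∸ j)) (if-false (≡ᵇ-false j n₁ j≢))) (ℚP.*-zeroˡ (liftX n₂ v m (a ∸ i) (b ∸ j)))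
    ... | yes _ | no k≢ = trans (cong (liftX n₁ u m i j ℚ.*_) (if-false (≡ᵇ-false (b ∸ j) n₂ k≢))) (ℚP.*-zeroʳ (liftX n₁ u m i j))
    ... | yes refl | yes e = ⊥-elim (b≢ (trans (sym (ℕP.m+[n∸m]≡n j≤b)) (cong (j +_) e)))

  δ : ℕ → S2
  δ k m a = if a ≡ᵇ k then 1ℚ else 0ℚ

  monoB-X : ∀ k n → monoB k n ≈ liftX n (δ k)
  monoB-X k n m a b with a ≡ᵇ k | b ≡ᵇ n
  ... | true | true = refl
  ... | true | false = refl
  ... | false | true = refl
  ... | false | false = refl

  δ⋆ : ∀ c u → (δ c ⋆ u) ≈S (λ m a → if c ≤ᵇ a then u m (a ∸ c) else 0ℚ)
  δ⋆ c u m a with c ℕP.≤? a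
  ... | yes c≤a = trans (Σ-single a c _ c≤a (λ i _ i≢ → trans (cong (ℚ._* u m (a ∸ i)) (if-false (≡ᵇ-false i c i≢))) (ℚP.*-zeroˡ (u m (a ∸ i)))))
     (trans (cong (ℚ._* u m (a ∸ c)) (if-true (≡ᵇ-true c c refl))) (trans (ℚP.*-identityˡ _) (sym (if-true (≤ᵇ-true c a c≤a)))))
  ... | no c≰a = trans (Σ-0 a _ (λ i i≤a → trans (cong (ℚ._* u m (a ∸ i)) (if-false (≡ᵇ-false i c (λ e → c≰a (subst (_≤ a) e i≤a))))) (ℚP.*-zeroˡ (u m (a ∸ i)))))
     (sym (if-false (≤ᵇ-false c a c≰a)))

  ⋆δ0 : ∀ u → (u ⋆ δ 0) ≈S u
  ⋆δ0 u m a = trans (Σ-single a a _ ℕP.≤-refl (λ i i≤a i≢ → trans (cong (u m i ℚ.*_) (if-false (≡ᵇ-false (a ∸ i) 0 (λ e → i≢ (ℕP.≤-antisym i≤a (ℕP.m∸n≡0⇒m≤n e)))))) (ℚP.*-zeroʳ (u m i))))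
     (trans (cong (λ z → u m a ℚ.* (if z ≡ᵇ 0 then 1ℚ else 0ℚ)) (ℕP.n∸n≡0 a)) (ℚP.*-identityʳ (u m a)))

module ShuffleSets where

  open BooleanTests

  ilv : List ℕ → List ℕ → List (List ℕ)
  ilv [] σ = σ ∷ []
  ilv (x ∷ π) [] = (x ∷ π) ∷ []
  ilv (x ∷ π) (y ∷ σ) = map (x ∷_) (ilv π (y ∷ σ)) ++ map (y ∷_) (ilv (x ∷ π) σ)

  disjoint-swap : ∀ {x y π σ} → x ∉ (y ∷ σ) → Disjoint π (y ∷ σ) → Disjoint (x ∷ π) σ
  disjoint-swap x∉ d = (λ m → x∉ (there m)) ∷ All.map (λ z∉ m → z∉ (there m)) d

  Unique-resp-↭ : ∀ {A : Set} {xs ys : List A} → xs ↭ ys → Unique xs → Unique ys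
  Unique-resp-↭ prefl u = u
  Unique-resp-↭ (prep x p) (a ∷ u) = PP.All-resp-↭ p a ∷ Unique-resp-↭ p u
  Unique-resp-↭ (swap x y p) ((x≢y ∷ ax) ∷ (ay ∷ u)) = ((λ e → x≢y (sym e)) ∷ PP.All-resp-↭ p ay) ∷ (PP.All-resp-↭ p ax ∷ Unique-resp-↭ p u)
  Unique-resp-↭ (ptrans p q) u = Unique-resp-↭ q (Unique-resp-↭ p u)

  ∈-concatMap⁺ : ∀ {A B : Set} (f : A → List B) {a b l} → a ∈ l → b ∈ f a → b ∈ concatMap f l
  ∈-concatMap⁺ f ma mb = MP.∈-concat⁺′ mb (MP.∈-map⁺ f ma)

  ∈-concatMap⁻ : ∀ {A B : Set} (f : A → List B) {b} l → b ∈ concatMap f l → ∃ λ a → a ∈ l × b ∈ f a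
  ∈-concatMap⁻ f l m with MP.∈-concat⁻′ (map f l) m
  ... | xs , mb , mxs with MP.∈-map⁻ f mxs
  ... | a , ma , refl = a , ma , mb

  insert-mem : ∀ x τ₁ τ₂ → τ₁ ++ x ∷ τ₂ ∈ insertEverywhere x (τ₁ ++ τ₂)
  insert-mem x [] [] = here refl
  insert-mem x [] (y ∷ τ₂) = here refl
  insert-mem x (z ∷ τ₁) τ₂ = there (MP.∈-map⁺ (z ∷_) (insert-mem x τ₁ τ₂))

  insert-↭ : ∀ x r {τ} → τ ∈ insertEverywhere x r → τ ↭ x ∷ r
  insert-↭ x [] (here refl) = ↭-refl
  insert-↭ x (y ∷ r) (here refl) = ↭-refl
  insert-↭ x (y ∷ r) (there m) with MP.∈-map⁻ (y ∷_) m
  ... | τ′ , m′ , refl = ↭-trans (prep y (insert-↭ x r m′)) (swap y x ↭-refl)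

  rearrangement-↭ : ∀ l {τ} → τ ∈ rearrangements l → τ ↭ l
  rearrangement-↭ [] (here refl) = ↭-refl
  rearrangement-↭ (x ∷ l) m with ∈-concatMap⁻ (insertEverywhere x) (rearrangements l) m
  ... | r , mr , mi = ↭-trans (insert-↭ x r mi) (prep x (rearrangement-↭ l mr))

  rearrangements-complete : ∀ l {τ} → τ ↭ l → τ ∈ rearrangements l
  rearrangements-complete [] p rewrite PP.↭-empty-inv p = here refl
  rearrangements-complete (x ∷ l) {τ} p with MP.∈-∃++ (PP.Any-resp-↭ (↭-sym p) (here refl))
  ... | τ₁ , τ₂ , refl = ∈-concatMap⁺ (insertEverywhere x) (rearrangements-complete l rest) (insert-mem x τ₁ τ₂)
    where
    rest : τ₁ ++ τ₂ ↭ l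
    rest = PP.drop-∷ (↭-trans (↭-sym (PP.shift x τ₁ τ₂)) p)

  -- deleting x undoes insertEverywhere x
  delete : ℕ → List ℕ → List ℕ
  delete x [] = []
  delete x (z ∷ τ) = if z ≡ᵇ x then delete x τ else z ∷ delete x τ

  delete-∉ : ∀ x r → x ∉ r → delete x r ≡ r
  delete-∉ x [] _ = refl
  delete-∉ x (z ∷ r) x∉ rewrite ≡ᵇ-false z x (λ e → x∉ (here (sym e))) = cong (z ∷_) (delete-∉ x r (λ m → x∉ (there m)))

  delete-insert : ∀ x r {τ} → x ∉ r → τ ∈ insertEverywhere x r → delete x τ ≡ r
  delete-insert x [] _ (here refl) rewrite ≡ᵇ-true x x refl = refl
  delete-insert x (y ∷ r) x∉ (here refl) rewrite ≡ᵇ-true x x refl = delete-∉ x (y ∷ r) x∉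
  delete-insert x (y ∷ r) x∉ (there m) with MP.∈-map⁻ (y ∷_) m
  ... | τ′ , m′ , refl rewrite ≡ᵇ-false y x (λ e → x∉ (here (sym e))) = cong (y ∷_) (delete-insert x r (λ m → x∉ (there m)) m′)

  unique-insert : ∀ x r → x ∉ r → Unique (insertEverywhere x r)
  unique-insert x [] _ = [] ∷ []
  unique-insert x (y ∷ r) x∉ = All.tabulate (λ {τ} m e → front τ m e) ∷ UP.map⁺ (λ e → proj₂ (LP.∷-injective e)) (unique-insert x r (λ m → x∉ (there m)))
    where
    front : ∀ τ → τ ∈ map (y ∷_) (insertEverywhere x r) → x ∷ y ∷ r ≡ τ → ⊥
    front τ m e with MP.∈-map⁻ (y ∷_) m
    ... | τ′ , _ , refl = x∉ (here (proj₁ (LP.∷-injective e)))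

  unique-insertAll : ∀ x R → Unique R → All (λ r → x ∉ r) R → Unique (concatMap (insertEverywhere x) R)
  unique-insertAll x [] _ _ = []
  unique-insertAll x (r ∷ R) (ar ∷ uR) (x∉r ∷ aR) = UP.++⁺ (unique-insert x r x∉r) (unique-insertAll x R uR aR) disjoint
    where
    disjoint : ∀ {τ} → ¬ (τ ∈ insertEverywhere x r × τ ∈ concatMap (insertEverywhere x) R)
    disjoint (m₁ , m₂) with ∈-concatMap⁻ (insertEverywhere x) R m₂
    ... | r′ , mr′ , mi = All.lookup ar mr′ (trans (sym (delete-insert x r x∉r m₁)) (delete-insert x r′ (All.lookup aR mr′) mi))

  unique-rearrangements : ∀ l → Unique l → Unique (rearrangements l)
  unique-rearrangements [] _ = [] ∷ []
  unique-rearrangements (x ∷ l) (ax ∷ ul) = unique-insertAll x (rearrangements l) (unique-rearrangements l ul)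
    (All.tabulate (λ {r} mr m → All.lookup ax (PP.Any-resp-↭ (rearrangement-↭ l mr) m) refl))

  ilv-[] : ∀ π {τ} → τ ∈ ilv π [] → τ ≡ π
  ilv-[] [] (here refl) = refl
  ilv-[] (x ∷ π) (here refl) = refl

  ilv-↭ : ∀ π σ {τ} → τ ∈ ilv π σ → τ ↭ π ++ σ
  ilv-↭ [] σ (here refl) = ↭-refl
  ilv-↭ (x ∷ π) [] (here refl) = ↭-sym (↭-reflexive (LP.++-identityʳ (x ∷ π)))
  ilv-↭ (x ∷ π) (y ∷ σ) m with MP.∈-++⁻ (map (x ∷_) (ilv π (y ∷ σ))) m
  ... | inj₁ m′ with MP.∈-map⁻ (x ∷_) m′
  ...   | τ′ , m″ , refl = prep x (ilv-↭ π (y ∷ σ) m″)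
  ilv-↭ (x ∷ π) (y ∷ σ) m | inj₂ m′ with MP.∈-map⁻ (y ∷_) m′
  ...   | τ′ , m″ , refl = ↭-trans (prep y (ilv-↭ (x ∷ π) σ m″)) (↭-sym (PP.shift y (x ∷ π) σ))

  ilv-length : ∀ π σ {τ} → τ ∈ ilv π σ → length τ ≡ length π + length σ
  ilv-length π σ m = trans (PP.↭-length (ilv-↭ π σ m)) (LP.length-++ π)

  ilv-⊇ : ∀ π σ {τ} → τ ∈ ilv π σ → π ⊆ τ × σ ⊆ τ
  ilv-⊇ [] σ (here refl) = minimum σ , ⊆-refl
  ilv-⊇ (x ∷ π) [] (here refl) = ⊆-refl , minimum (x ∷ π)
  ilv-⊇ (x ∷ π) (y ∷ σ) m with MP.∈-++⁻ (map (x ∷_) (ilv π (y ∷ σ))) m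
  ... | inj₁ m′ with MP.∈-map⁻ (x ∷_) m′
  ...   | τ′ , m″ , refl with ilv-⊇ π (y ∷ σ) m″
  ...     | s₁ , s₂ = (refl ∷ s₁) , (x ∷ˢ s₂)
  ilv-⊇ (x ∷ π) (y ∷ σ) m | inj₂ m′ with MP.∈-map⁻ (y ∷_) m′
  ...   | τ′ , m″ , refl with ilv-⊇ (x ∷ π) σ m″
  ...     | s₁ , s₂ = (y ∷ˢ s₁) , (refl ∷ s₂)

  -- conversely, a repetition-free rearrangement of π ++ σ containing π and σ
  -- is an interleaving: its first letter is the first letter of π or of σ
  interleaving : ∀ π σ τ → Unique τ → Disjoint π σ → π ⊆ τ → σ ⊆ τ → τ ↭ π ++ σ → τ ∈ ilv π σ
  interleaving [] [] [] u d [] [] p = here refl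
  interleaving π σ (z ∷ τ) (az ∷ uτ) d (.z ∷ˢ s₁) (.z ∷ˢ s₂) p with MP.∈-++⁻ π (PP.Any-resp-↭ p (here refl))
  ... | inj₁ mπ = ⊥-elim (All.lookup az (⊆-lookup s₁ mπ) refl)
  ... | inj₂ mσ = ⊥-elim (All.lookup az (⊆-lookup s₂ mσ) refl)
  interleaving (z ∷ π) σ (.z ∷ τ) (az ∷ uτ) (z∉ ∷ d) (refl ∷ s₁) (.z ∷ˢ s₂) p = from-π σ (interleaving π σ τ uτ d s₁ s₂ (PP.drop-∷ p))
    where
    from-π : ∀ σ → τ ∈ ilv π σ → z ∷ τ ∈ ilv (z ∷ π) σ
    from-π [] m = here (cong (z ∷_) (ilv-[] π m))
    from-π (y ∷ σ′) m = MP.∈-++⁺ˡ (MP.∈-map⁺ (z ∷_) m)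
  interleaving π (z ∷ σ) (.z ∷ τ) (az ∷ uτ) d (.z ∷ˢ s₁) (refl ∷ s₂) p =
    from-σ π (interleaving π σ τ uτ (All.map (λ z∉ m → z∉ (there m)) d) s₁ s₂ (PP.drop-∷ (↭-trans p (PP.shift z π σ))))
    where
    from-σ : ∀ π → τ ∈ ilv π σ → z ∷ τ ∈ ilv π (z ∷ σ)
    from-σ [] (here refl) = here refl
    from-σ (x ∷ π′) m = MP.∈-++⁺ʳ (map (x ∷_) (ilv π′ (z ∷ σ))) (MP.∈-map⁺ (z ∷_) m)
  interleaving (z ∷ π) (.z ∷ σ) (.z ∷ τ) u (z∉ ∷ d) (refl ∷ s₁) (refl ∷ s₂) p = ⊥-elim (z∉ (here refl))

  unique-ilv : ∀ π σ → Disjoint π σ → Unique (ilv π σ)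
  unique-ilv [] σ d = [] ∷ []
  unique-ilv (x ∷ π) [] d = [] ∷ []
  unique-ilv (x ∷ π) (y ∷ σ) (x∉ ∷ d) = UP.++⁺ (UP.map⁺ (λ e → proj₂ (LP.∷-injective e)) (unique-ilv π (y ∷ σ) d))
    (UP.map⁺ (λ e → proj₂ (LP.∷-injective e)) (unique-ilv (x ∷ π) σ (disjoint-swap x∉ d))) first-letters
    where
    first-letters : ∀ {τ} → ¬ (τ ∈ map (x ∷_) (ilv π (y ∷ σ)) × τ ∈ map (y ∷_) (ilv (x ∷ π) σ))
    first-letters (m₁ , m₂) with MP.∈-map⁻ (x ∷_) m₁ | MP.∈-map⁻ (y ∷_) m₂
    ... | _ , _ , refl | _ , _ , e = x∉ (here (proj₁ (LP.∷-injective e)))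

  unique-++ : ∀ π σ → IsPerm π → IsPerm σ → Disjoint π σ → Unique (π ++ σ)
  unique-++ π σ (uπ , _) (uσ , _) d = UP.++⁺ uπ uσ (λ (m₁ , m₂) → All.lookup d m₁ m₂)

  -- both lists are repetition-free and have the same elements
  shuffles-↭-ilv : ∀ π σ → IsPerm π → IsPerm σ → Disjoint π σ → shuffles π σ ↭ ilv π σ
  shuffles-↭-ilv π σ pπ pσ d = ∼bag⇒↭ (unique∧set⇒bag unique-shuffles (unique-ilv π σ d) (mk⇔ to from))
    where
    uπσ : Unique (π ++ σ)
    uπσ = unique-++ π σ pπ pσ d
    unique-shuffles : Unique (shuffles π σ)
    unique-shuffles = UP.filter⁺ (λ τ → π ⊆? τ) (UP.filter⁺ (λ τ → σ ⊆? τ) (unique-rearrangements (π ++ σ) uπσ))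
    to : ∀ {τ} → τ ∈ shuffles π σ → τ ∈ ilv π σ
    to {τ} m with MP.∈-filter⁻ (λ τ → π ⊆? τ) m
    ... | m′ , s₁ with MP.∈-filter⁻ (λ τ → σ ⊆? τ) m′
    ... | m″ , s₂ = interleaving π σ τ (Unique-resp-↭ (↭-sym (rearrangement-↭ (π ++ σ) m″)) uπσ) d s₁ s₂ (rearrangement-↭ (π ++ σ) m″)
    from : ∀ {τ} → τ ∈ ilv π σ → τ ∈ shuffles π σ
    from {τ} m = MP.∈-filter⁺ (λ τ → π ⊆? τ) (MP.∈-filter⁺ (λ τ → σ ⊆? τ) (rearrangements-complete (π ++ σ) (ilv-↭ π σ m)) (proj₂ (ilv-⊇ π σ m))) (proj₁ (ilv-⊇ π σ m))

  shuffle-isPerm : ∀ π σ → IsPerm π → IsPerm σ → Disjoint π σ → ∀ {τ} → τ ∈ shuffles π σ → IsPerm τ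
  shuffle-isPerm π σ pπ pσ d {τ} m with MP.∈-filter⁻ (λ τ → π ⊆? τ) m
  ... | m′ , _ with MP.∈-filter⁻ (λ τ → σ ⊆? τ) m′
  ... | m″ , _ = Unique-resp-↭ (↭-sym q) (unique-++ π σ pπ pσ d) , PP.All-resp-↭ (↭-sym q) (AllP.++⁺ (proj₂ pπ) (proj₂ pσ))
    where
    q : τ ↭ π ++ σ
    q = rearrangement-↭ (π ++ σ) m″

-- Finite multisets of exponents, represented as lists up to rearrangement
-- (↭).  A list A stands for the polynomial Σ_{a ∈ A} q^a; A ⊗ B is the list
-- of the product polynomial and keep b A is "A if b holds, else nothing".
module ExponentMultisets where

  keep : Bool → List ℕ → List ℕ
  keep b X = if b then X else []

  concatMap-resp-↭ : ∀ {A : Set} (F : A → List ℕ) {l₁ l₂} → l₁ ↭ l₂ → concatMap F l₁ ↭ concatMap F l₂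
  concatMap-resp-↭ F prefl = ↭-refl
  concatMap-resp-↭ F (prep x p) = PP.++⁺ˡ (F x) (concatMap-resp-↭ F p)
  concatMap-resp-↭ F (swap x y p) = ↭-trans (PP.shifts (F x) (F y)) (PP.++⁺ˡ (F y) (PP.++⁺ˡ (F x) (concatMap-resp-↭ F p)))
  concatMap-resp-↭ F (ptrans p q) = ↭-trans (concatMap-resp-↭ F p) (concatMap-resp-↭ F q)

  concatMap-cong-↭ : ∀ {A : Set} {F G : A → List ℕ} l → (∀ u → F u ↭ G u) → concatMap F l ↭ concatMap G l
  concatMap-cong-↭ [] h = ↭-refl
  concatMap-cong-↭ (x ∷ l) h = PP.++⁺ (h x) (concatMap-cong-↭ l h)

  concatMap-++-↭ : ∀ {A : Set} (F G : A → List ℕ) l → concatMap (λ u → F u ++ G u) l ↭ concatMap F l ++ concatMap G l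
  concatMap-++-↭ F G [] = ↭-refl
  concatMap-++-↭ F G (x ∷ l) = ↭-trans (↭-reflexive (LP.++-assoc (F x) (G x) _))
    (↭-trans (PP.++⁺ˡ (F x) (PP.++⁺ˡ (G x) (concatMap-++-↭ F G l)))
    (↭-trans (PP.++⁺ˡ (F x) (PP.shifts (G x) (concatMap F l))) (↭-reflexive (sym (LP.++-assoc (F x) _ _)))))

  concatMap-swap : ∀ {A B : Set} (F : A → B → List ℕ) l₁ l₂ →
    concatMap (λ u → concatMap (F u) l₂) l₁ ↭ concatMap (λ v → concatMap (λ u → F u v) l₁) l₂
  concatMap-swap F [] l₂ = ↭-reflexive (sym (empty l₂))
    where
    empty : ∀ {B : Set} (l : List B) → concatMap (λ _ → []) l ≡ []
    empty [] = refl
    empty (x ∷ l) = empty l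
  concatMap-swap F (x ∷ l₁) l₂ = ↭-trans (PP.++⁺ˡ (concatMap (F x) l₂) (concatMap-swap F l₁ l₂))
    (↭-sym (concatMap-++-↭ (F x) (λ v → concatMap (λ u → F u v) l₁) l₂))

  concatMap-∷ʳ : ∀ {A : Set} (F : A → List ℕ) l x → concatMap F (l ∷ʳ x) ≡ concatMap F l ++ F x
  concatMap-∷ʳ F l x = trans (LP.concatMap-++ F l (x ∷ [])) (cong (concatMap F l ++_) (LP.++-identityʳ (F x)))

  keep-concatMap : ∀ {A : Set} b (F : A → List ℕ) l → keep b (concatMap F l) ≡ concatMap (λ v → keep b (F v)) l
  keep-concatMap true F l = refl
  keep-concatMap false F [] = refl
  keep-concatMap false F (x ∷ l) = keep-concatMap false F l

  keep-↭ : ∀ b {X Y} → X ↭ Y → keep b X ↭ keep b Y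
  keep-↭ true p = p
  keep-↭ false p = ↭-refl

  infixl 7 _⊗_
  _⊗_ : List ℕ → List ℕ → List ℕ
  A ⊗ B = concatMap (λ i → map (i +_) B) A

  ⊗-concatMapˡ : ∀ {A : Set} (F : A → List ℕ) l B → concatMap F l ⊗ B ≡ concatMap (λ u → F u ⊗ B) l
  ⊗-concatMapˡ F [] B = refl
  ⊗-concatMapˡ F (x ∷ l) B = trans (LP.concatMap-++ (λ i → map (i +_) B) (F x) (concatMap F l)) (cong (F x ⊗ B ++_) (⊗-concatMapˡ F l B))

  ⊗-concatMapʳ : ∀ {A : Set} (F : A → List ℕ) l B → B ⊗ concatMap F l ↭ concatMap (λ v → B ⊗ F v) l
  ⊗-concatMapʳ F l B = ↭-trans (↭-reflexive (LP.concatMap-cong (λ i → LP.map-concatMap (i +_) F l) B))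
    (concatMap-swap (λ i v → map (i +_) (F v)) B l)

  ⊗-[]ʳ : ∀ A → A ⊗ [] ≡ []
  ⊗-[]ʳ [] = refl
  ⊗-[]ʳ (x ∷ A) = ⊗-[]ʳ A

  shift-⊗ˡ : ∀ c A B → map (c +_) A ⊗ B ≡ map (c +_) (A ⊗ B)
  shift-⊗ˡ c [] B = refl
  shift-⊗ˡ c (x ∷ A) B = trans (cong₂ _++_ (trans (LP.map-cong (λ y → ℕP.+-assoc c x y) B) (LP.map-∘ B)) (shift-⊗ˡ c A B))
     (sym (LP.map-++ (c +_) (map (x +_) B) (A ⊗ B)))

  shift-⊗ʳ : ∀ c A B → A ⊗ map (c +_) B ≡ map (c +_) (A ⊗ B)
  shift-⊗ʳ c A B = trans (LP.concatMap-cong (λ i → trans (sym (LP.map-∘ B)) (trans (LP.map-cong (λ y → swap-+ i y) B) (LP.map-∘ B))) A)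
     (sym (LP.map-concatMap (c +_) (λ i → map (i +_) B) A))
    where
    swap-+ : ∀ i y → i + (c + y) ≡ c + (i + y)
    swap-+ i y = trans (sym (ℕP.+-assoc i c y)) (trans (cong (_+ y) (ℕP.+-comm i c)) (ℕP.+-assoc c i y))

  ⊗-identityˡ : ∀ B → (0 ∷ []) ⊗ B ≡ B
  ⊗-identityˡ B = trans (LP.++-identityʳ _) (LP.map-id B)

  ⊗-identityʳ : ∀ A → A ⊗ (0 ∷ []) ≡ A
  ⊗-identityʳ [] = refl
  ⊗-identityʳ (x ∷ A) = cong₂ _∷_ (ℕP.+-identityʳ x) (⊗-identityʳ A)

  keep-⊗ˡ : ∀ b X B → keep b X ⊗ B ≡ keep b (X ⊗ B)
  keep-⊗ˡ true X B = refl
  keep-⊗ˡ false X B = refl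

  keep-⊗ʳ : ∀ b A Y → A ⊗ keep b Y ≡ keep b (A ⊗ Y)
  keep-⊗ʳ true A Y = refl
  keep-⊗ʳ false A Y = ⊗-[]ʳ A

-- Multiplicities: cnt a A is the coefficient of q^a in the polynomial of A.
module GaussianMultisets where

  cnt : ℕ → List ℕ → ℕ
  cnt a [] = 0
  cnt a (x ∷ l) = (if x ≡ᵇ a then 1 else 0) + cnt a l

  cnt-++ : ∀ a l₁ l₂ → cnt a (l₁ ++ l₂) ≡ cnt a l₁ + cnt a l₂
  cnt-++ a [] l₂ = refl
  cnt-++ a (x ∷ l₁) l₂ = trans (cong (_ +_) (cnt-++ a l₁ l₂)) (sym (ℕP.+-assoc (if x ≡ᵇ a then 1 else 0) _ _))

  cnt-↭ : ∀ a {l₁ l₂} → l₁ ↭ l₂ → cnt a l₁ ≡ cnt a l₂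
  cnt-↭ a prefl = refl
  cnt-↭ a (prep x p) = cong (_ +_) (cnt-↭ a p)
  cnt-↭ a (swap x y p) = exchange (if x ≡ᵇ a then 1 else 0) (if y ≡ᵇ a then 1 else 0) (cnt-↭ a p)
    where
    exchange : ∀ p q {r s} → r ≡ s → p + (q + r) ≡ q + (p + s)
    exchange p q {r} refl = trans (sym (ℕP.+-assoc p q r)) (trans (cong (_+ r) (ℕP.+-comm p q)) (ℕP.+-assoc q p r))
  cnt-↭ a (ptrans p q) = trans (cnt-↭ a p) (cnt-↭ a q)

  private
    shift-≡ᵇ : ∀ c x a → (c + x ≡ᵇ a) ≡ (if c ≤ᵇ a then x ≡ᵇ (a ∸ c) else false)
    shift-≡ᵇ zero x a = refl
    shift-≡ᵇ (suc c) x zero = refl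
    shift-≡ᵇ (suc zero) x (suc a) = refl
    shift-≡ᵇ (suc (suc c)) x (suc a) = shift-≡ᵇ (suc c) x a

  cnt-shift : ∀ c a l → cnt a (map (c +_) l) ≡ (if c ≤ᵇ a then cnt (a ∸ c) l else 0)
  cnt-shift c a [] with c ≤ᵇ a
  ... | true = refl
  ... | false = refl
  cnt-shift c a (x ∷ l) rewrite shift-≡ᵇ c x a | cnt-shift c a l with c ≤ᵇ a
  ... | true = refl
  ... | false = refl

  -- QB N k: the q-Pascal recursion of qbin, read as a multiset
  QB : ℕ → ℕ → List ℕ
  QB zero zero = 0 ∷ []
  QB zero (suc k) = []
  QB (suc N) zero = 0 ∷ []
  QB (suc N) (suc k) = QB N k ++ map (suc k +_) (QB N (suc k))

  cnt-QB : ∀ N k a → cnt a (QB N k) ≡ qbin N k a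
  cnt-QB zero zero zero = refl
  cnt-QB zero zero (suc a) = refl
  cnt-QB zero (suc k) a = refl
  cnt-QB (suc N) zero zero = refl
  cnt-QB (suc N) zero (suc a) = refl
  cnt-QB (suc N) (suc k) a = trans (cnt-++ a (QB N k) _) (cong₂ _+_ (cnt-QB N k a)
     (trans (cnt-shift (suc k) a (QB N (suc k))) (shifted (suc k ≤ᵇ a))))
    where
    shifted : ∀ b → (if b then cnt (a ∸ suc k) (QB N (suc k)) else 0) ≡ (if b then qbin N (suc k) (a ∸ suc k) else 0)
    shifted true = cnt-QB N (suc k) (a ∸ suc k)
    shifted false = refl

  qbin-0 : ∀ N a → qbin N 0 a ≡ (if a ≡ᵇ 0 then 1 else 0)
  qbin-0 zero a = refl
  qbin-0 (suc N) a = refl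

  QB-small : ∀ N k → N < k → QB N k ≡ []
  QB-small zero (suc k) _ = refl
  QB-small (suc N) (suc k) (s≤s lt) = trans (cong (_++ map (suc k +_) (QB N (suc k))) (QB-small N k lt))
     (cong (map (suc k +_)) (QB-small N (suc k) (ℕP.m<n⇒m<1+n lt)))

  QB-diagonal : ∀ n → QB n n ≡ 0 ∷ []
  QB-diagonal zero = refl
  QB-diagonal (suc n) = cong₂ _++_ (QB-diagonal n) (cong (map (suc n +_)) (QB-small n (suc n) ℕP.≤-refl))

  QB-0 : ∀ N → QB N 0 ≡ 0 ∷ []
  QB-0 zero = refl
  QB-0 (suc N) = refl

  upTo-suc : ∀ n → upTo (suc n) ≡ 0 ∷ map suc (upTo n)
  upTo-suc n = cong (0 ∷_) (sym (LP.map-upTo suc n))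

  QB-1 : ∀ N → QB N 1 ≡ upTo N
  QB-1 zero = refl
  QB-1 (suc N) = trans (cong₂ (λ a b → a ++ map suc b) (QB-0 N) (QB-1 N)) (sym (upTo-suc N))

  hockey : ∀ R k → QB (R + k) (suc k) ↭ concatMap (λ r → map ((suc k ℕ.* r) +_) (QB ((R ∸ suc r) + k) k)) (upTo R)
  hockey zero k = ↭-reflexive (QB-small k (suc k) ℕP.≤-refl)
  hockey (suc R) k = ↭-trans (PP.++⁺ˡ (QB (R + k) k) (PP.map⁺ (suc k +_) (hockey R k)))
    (↭-reflexive (sym (trans (cong (concatMap T) (upTo-suc R)) (cong₂ _++_ first (trans (LP.concatMap-map T suc (upTo R)) (sym rest))))))
    where
    T : ℕ → List ℕ
    T r = map ((suc k ℕ.* r) +_) (QB ((suc R ∸ suc r) + k) k)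
    first : T 0 ≡ QB (R + k) k
    first = trans (LP.map-cong (λ y → cong (_+ y) (ℕP.*-zeroʳ (suc k))) (QB (R + k) k)) (LP.map-id (QB (R + k) k))
    rest : map (suc k +_) (concatMap (λ r → map ((suc k ℕ.* r) +_) (QB ((R ∸ suc r) + k) k)) (upTo R))
         ≡ concatMap (λ r → T (suc r)) (upTo R)
    rest = trans (LP.map-concatMap (suc k +_) _ (upTo R)) (LP.concatMap-cong (λ r → trans (sym (LP.map-∘ _))
       (LP.map-cong (λ y → trans (sym (ℕP.+-assoc (suc k) _ y)) (cong (_+ y) (sym (ℕP.*-suc (suc k) r)))) _)) (upTo R))

  -- the same identity with the binomial index k + 1 ≥ 1 made explicit
  hockey′ : ∀ R n → QB (R + suc n) (suc (suc n)) ↭ concatMap (λ r → map ((suc (suc n) ℕ.* r) +_) (QB ((R ∸ r) + n) (suc n))) (upTo R)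
  hockey′ R n = ↭-trans (hockey R (suc n)) (↭-reflexive (cong concat (LP.map-cong-local
    (AllP.applyUpTo⁺₁ (λ r → r) R (λ {r} r<R → cong (λ z → map ((suc (suc n) ℕ.* r) +_) (QB z (suc n))) (index r<R))))))
    where
    index : ∀ {r} → r < R → (R ∸ suc r) + suc n ≡ (R ∸ r) + n
    index {r} r<R = trans (ℕP.+-suc (R ∸ suc r) n) (cong (_+ n) (sym (ℕP.+-∸-assoc 1 r<R)))

module PPartitions where

  open ℕ-Solver using (solve; _:+_; _:*_; _:=_; con)
  open BooleanTests
  open ExponentMultisets
  open GaussianMultisets

  desHead : ℕ → List ℕ → ℕ
  desHead x [] = 0
  desHead x (y ∷ _) = if y <ᵇ x then 1 else 0

  descentsFrom-suc : ∀ i l → descentsFrom (suc i) l ≡ map suc (descentsFrom i l)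
  descentsFrom-suc i [] = refl
  descentsFrom-suc i (x ∷ []) = refl
  descentsFrom-suc i (x ∷ y ∷ l) with y <ᵇ x | descentsFrom-suc (suc i) (y ∷ l)
  ... | true | ih = cong (suc i ∷_) ih
  ... | false | ih = ih

  des-∷ : ∀ x w → des (x ∷ w) ≡ desHead x w + des w
  des-∷ x [] = refl
  des-∷ x (y ∷ w) with y <ᵇ x
  ... | true = cong suc (trans (cong length (descentsFrom-suc 1 (y ∷ w))) (LP.length-map suc (descentsFrom 1 (y ∷ w))))
  ... | false = trans (cong length (descentsFrom-suc 1 (y ∷ w))) (LP.length-map suc (descentsFrom 1 (y ∷ w)))

  comaj-∷ : ∀ x w → comaj (x ∷ w) ≡ desHead x w ℕ.* length w + comaj w
  comaj-∷ x [] = refl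
  comaj-∷ x (y ∷ w) with y <ᵇ x
  ... | true = cong₂ _+_ (sym (ℕP.+-identityʳ (length (y ∷ w)))) shifted
    where
    shifted : sum (map (λ i → suc (length (y ∷ w)) ∸ i) (descentsFrom 2 (y ∷ w))) ≡ comaj (y ∷ w)
    shifted = cong sum (trans (cong (map _) (descentsFrom-suc 1 (y ∷ w))) (sym (LP.map-∘ (descentsFrom 1 (y ∷ w)))))
  ... | false = cong sum (trans (cong (map _) (descentsFrom-suc 1 (y ∷ w))) (sym (LP.map-∘ (descentsFrom 1 (y ∷ w)))))

  -- H P w m: the sizes of the w-partitions with parts in [m, P], i.e. the
  -- sequences m ≤ f₁ ≤ f₂ ≤ ... ≤ P with f_i < f_{i+1} at the descents of w
  H : ℕ → List ℕ → ℕ → List ℕ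
  H P [] m = 0 ∷ []
  H P (x ∷ w) m = concatMap (λ u → keep (m ≤ᵇ u) (map (u +_) (H P w (u + desHead x w)))) (upTo P)

  concatMap-upTo-suc : ∀ (F : ℕ → List ℕ) P → concatMap F (upTo (suc P)) ≡ concatMap F (upTo P) ++ F P
  concatMap-upTo-suc F P = trans (cong (concatMap F) (sym (LP.upTo-∷ʳ P))) (concatMap-∷ʳ F (upTo P) P)

  guarded-range : ∀ (F : ℕ → List ℕ) m P → concatMap (λ u → keep (m ≤ᵇ u) (F u)) (upTo P) ≡ concatMap (λ r → F (m + r)) (upTo (P ∸ m))
  guarded-range F m zero = cong (λ z → concatMap (λ r → F (m + r)) (upTo z)) (sym (ℕP.0∸n≡0 m))
  guarded-range F m (suc P) with m ℕP.≤? P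
  ... | yes m≤P = trans (concatMap-upTo-suc _ P)
     (trans (cong₂ _++_ (guarded-range F m P) (trans (cong (λ z → keep z (F P)) (≤ᵇ-true m P m≤P)) (cong F (sym (ℕP.m+[n∸m]≡n m≤P)))))
     (trans (sym (concatMap-upTo-suc (λ r → F (m + r)) (P ∸ m))) (cong (λ z → concatMap (λ r → F (m + r)) (upTo z)) (sym (ℕP.+-∸-assoc 1 m≤P)))))
  ... | no m≰P = trans (concatMap-upTo-suc _ P)
     (trans (cong₂ _++_ (trans (guarded-range F m P) (cong (λ z → concatMap (λ r → F (m + r)) (upTo z)) (ℕP.m≤n⇒m∸n≡0 (ℕP.<⇒≤ (ℕP.≰⇒> m≰P)))))
            (cong (λ z → keep z (F P)) (≤ᵇ-false m P m≰P)))
     (cong (λ z → concatMap (λ r → F (m + r)) (upTo z)) (sym (ℕP.m≤n⇒m∸n≡0 (ℕP.≰⇒> m≰P)))))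

  truncate-range : ∀ (T : ℕ → List ℕ) R X → (∀ r → R ≤ r → T r ≡ []) → R ≤ X → concatMap T (upTo X) ≡ concatMap T (upTo R)
  truncate-range T R X h R≤X with R ℕP.≟ X
  ... | yes refl = refl
  truncate-range T R zero h R≤X | no R≢X = ⊥-elim (R≢X (ℕP.n≤0⇒n≡0 R≤X))
  truncate-range T R (suc X) h R≤X | no R≢X = trans (concatMap-upTo-suc T X)
     (trans (cong₂ _++_ (truncate-range T R X h R≤X′) (h X R≤X′)) (LP.++-identityʳ _))
    where
    R≤X′ : R ≤ X
    R≤X′ = ℕP.≤-pred (ℕP.≤∧≢⇒< R≤X R≢X)

  concatMap-singleton : ∀ (f : ℕ → ℕ) l → concatMap (λ r → f r ∷ []) l ≡ map f l
  concatMap-singleton f [] = refl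
  concatMap-singleton f (x ∷ l) = cong (f x ∷_) (concatMap-singleton f l)

  -- Induction on w: sum the closed form for w over the first part u and
  -- recognise the hockey-stick identity.
  closedForm : ∀ P x w m → H P (x ∷ w) m ↭ map ((m ℕ.* suc (length w) + comaj (x ∷ w)) +_) (QB ((P ∸ m ∸ des (x ∷ w)) + length w) (suc (length w)))
  closedForm P x [] m = ↭-reflexive (trans (guarded-range (λ u → map (u +_) (0 ∷ [])) m P) (trans (concatMap-singleton (λ r → m + r + 0) (upTo (P ∸ m)))
     (sym (trans (cong (map _) (trans (cong (λ z → QB z 1) (ℕP.+-identityʳ (P ∸ m))) (QB-1 (P ∸ m))))
          (LP.map-cong (λ r → exponent r) (upTo (P ∸ m)))))))
    where
    exponent : ∀ r → m ℕ.* 1 + 0 + r ≡ m + r + 0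
    exponent r = solve 2 (λ m r → m :* con 1 :+ con 0 :+ r := m :+ r :+ con 0) refl m r
  closedForm P x (y ∷ w′) m =
    ↭-trans (concatMap-cong-↭ (upTo P) (λ u → keep-↭ (m ≤ᵇ u) (PP.map⁺ (u +_) (closedForm P y w′ (u + δ)))))
    (↭-trans (↭-reflexive (trans (guarded-range _ m P) (trans (LP.concatMap-cong term (upTo (P ∸ m))) (sym (LP.map-concatMap (K +_) T (upTo (P ∸ m)))))))
    (↭-trans (↭-reflexive (cong (map (K +_)) (truncate-range T R (P ∸ m) vanish (ℕP.m∸n≤m (P ∸ m) D))))
    (↭-trans (PP.map⁺ (K +_) (↭-sym (hockey′ R n′))) (↭-reflexive (cong₂ (λ a b → map (a +_) (QB (P ∸ m ∸ b + suc n′) (suc (suc n′)))) Keq (sym (des-∷ x w)))))))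
    where
    w : List ℕ
    w = y ∷ w′
    n′ : ℕ
    n′ = length w′
    δ dw cw D R K : ℕ
    δ = desHead x w
    dw = des w
    cw = comaj w
    D = δ + dw
    R = P ∸ m ∸ D
    K = m ℕ.* suc (suc n′) + (δ ℕ.* suc n′ + cw)
    T : ℕ → List ℕ
    T r = map ((suc (suc n′) ℕ.* r) +_) (QB ((R ∸ r) + n′) (suc n′))
    vanish : ∀ r → R ≤ r → T r ≡ []
    vanish r R≤r = cong (map _) (trans (cong (λ z → QB (z + n′) (suc n′)) (ℕP.m≤n⇒m∸n≡0 R≤r)) (QB-small n′ (suc n′) ℕP.≤-refl))
    Keq : K ≡ m ℕ.* suc (length w) + comaj (x ∷ w)
    Keq = cong (m ℕ.* suc (length w) +_) (sym (comaj-∷ x w))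
    term : ∀ r → map ((m + r) +_) (map (((m + r + δ) ℕ.* suc n′ + cw) +_) (QB ((P ∸ (m + r + δ) ∸ dw) + n′) (suc n′)))
               ≡ map (K +_) (T r)
    term r = trans (sym (LP.map-∘ _)) (trans (LP.map-cong e _) (trans (cong (map _) (cong (λ z → QB (z + n′) (suc n′)) arg)) (LP.map-∘ _)))
      where
      e : ∀ z → (m + r) + (((m + r + δ) ℕ.* suc n′ + cw) + z) ≡ K + ((suc (suc n′) ℕ.* r) + z)
      e z = solve 6 (λ m r δ n cw z → (m :+ r) :+ (((m :+ r :+ δ) :* (con 1 :+ n) :+ cw) :+ z)
                                     := (m :* (con 2 :+ n) :+ (δ :* (con 1 :+ n) :+ cw)) :+ (((con 2 :+ n) :* r) :+ z)) refl m r δ n′ cw z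
      arg : P ∸ (m + r + δ) ∸ dw ≡ R ∸ r
      arg = trans (ℕP.∸-+-assoc P (m + r + δ) dw) (trans (cong (P ∸_) (solve 4 (λ m r δ d → m :+ r :+ δ :+ d := m :+ ((δ :+ d) :+ r)) refl m r δ dw))
            (sym (trans (ℕP.∸-+-assoc (P ∸ m) D r) (ℕP.∸-+-assoc P m (D + r)))))

-- The fundamental lemma of P-partitions: for disjoint words π and σ, pairs
-- of a π-partition and a σ-partition correspond bijectively (and
-- size-preservingly) to τ-partitions for the interleavings τ of π and σ.
module FundamentalLemma where

  open ℕ-Solver using (solve; _:+_; _:=_)
  open BooleanTests
  open ExponentMultisets
  open PPartitions
  open ShuffleSets using (ilv; disjoint-swap)

  -- The lower bound for the first part of w: after a part v at letter c the
  -- next part is ≥ v, and > v if the letter decreases.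
  lowerBound : Maybe (ℕ × ℕ) → List ℕ → ℕ
  lowerBound nothing w = 0
  lowerBound (just _) [] = 0
  lowerBound (just (v , c)) (y ∷ _) = v + (if y <ᵇ c then 1 else 0)

  -- G P L w: the sizes of the w-partitions with parts ≤ P that may follow L
  G : ℕ → Maybe (ℕ × ℕ) → List ℕ → List ℕ
  G P L w = H P w (lowerBound L w)

  G-∷ : ∀ P L x w → G P L (x ∷ w) ≡ concatMap (λ u → keep (lowerBound L (x ∷ w) ≤ᵇ u) (map (u +_) (G P (just (u , x)) w))) (upTo P)
  G-∷ P L x w = LP.concatMap-cong (λ u → cong (λ z → keep (lowerBound L (x ∷ w) ≤ᵇ u) (map (u +_) z)) (H-next u w)) (upTo P)
    where
    H-next : ∀ u w → H P w (u + desHead x w) ≡ G P (just (u , x)) w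
    H-next u [] = refl
    H-next u (y ∷ w) = refl

  G-∷′ : ∀ P L x π τ → concatMap (λ u → keep (lowerBound L (x ∷ π) ≤ᵇ u) (map (u +_) (G P (just (u , x)) τ))) (upTo P) ≡ G P L (x ∷ τ)
  G-∷′ P L x π τ = trans (cong (λ m → concatMap (λ u → keep (m ≤ᵇ u) (map (u +_) (G P (just (u , x)) τ))) (upTo P)) (first-letter L)) (sym (G-∷ P L x τ))
    where
    first-letter : ∀ L → lowerBound L (x ∷ π) ≡ lowerBound L (x ∷ τ)
    first-letter nothing = refl
    first-letter (just _) = refl

  split-keep : ∀ b₁ b₂ b₃ b₄ Z → (b₁ ≡ true → b₃ ≡ true → b₂ ≡ true) → (b₂ ≡ true → b₄ ≡ true → b₁ ≡ true)
    → (b₃ ≡ true → b₄ ≡ true → ⊥) → (b₃ ≡ false → b₄ ≡ false → ⊥)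
    → keep b₁ (keep b₂ Z) ↭ keep b₁ (keep b₃ Z) ++ keep b₂ (keep b₄ Z)
  split-keep true true true true Z h₁ h₂ h₃ h₄ = ⊥-elim (h₃ refl refl)
  split-keep true true true false Z h₁ h₂ h₃ h₄ = ↭-sym (↭-reflexive (LP.++-identityʳ Z))
  split-keep true true false true Z h₁ h₂ h₃ h₄ = ↭-refl
  split-keep true true false false Z h₁ h₂ h₃ h₄ = ⊥-elim (h₄ refl refl)
  split-keep true false true b₄ Z h₁ h₂ h₃ h₄ with h₁ refl refl
  ... | ()
  split-keep true false false b₄ Z h₁ h₂ h₃ h₄ = ↭-refl
  split-keep false true b₃ true Z h₁ h₂ h₃ h₄ with h₂ refl refl
  ... | ()
  split-keep false true b₃ false Z h₁ h₂ h₃ h₄ = ↭-refl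
  split-keep false false b₃ b₄ Z h₁ h₂ h₃ h₄ = ↭-refl

  bit : Bool → ℕ
  bit b = if b then 1 else 0

  bound-trans : ∀ L x y π σ u v → (lowerBound L (x ∷ π) ≤ᵇ u) ≡ true → (u + bit (y <ᵇ x) ≤ᵇ v) ≡ true → (lowerBound L (y ∷ σ) ≤ᵇ v) ≡ true
  bound-trans nothing x y π σ u v _ _ = refl
  bound-trans (just (w , c)) x y π σ u v e₁ e₂ = ≤ᵇ-true _ _ (chain (≤ᵇ-sound _ _ e₁) (≤ᵇ-sound _ _ e₂))
    where
    chain : w + bit (x <ᵇ c) ≤ u → u + bit (y <ᵇ x) ≤ v → w + bit (y <ᵇ c) ≤ v
    chain p q with y <ᵇ c in eyc | x <ᵇ c in exc | y <ᵇ x in eyx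
    ... | false | b | b′ = ℕP.≤-trans (ℕP.+-monoʳ-≤ w z≤n) (ℕP.≤-trans p (ℕP.≤-trans (ℕP.m≤m+n u (bit b′)) q))
    ... | true | true | b′ = ℕP.≤-trans p (ℕP.≤-trans (ℕP.m≤m+n u (bit b′)) q)
    ... | true | false | true = ℕP.≤-trans (ℕP.+-monoˡ-≤ 1 (ℕP.≤-trans (ℕP.m≤m+n w 0) p)) q
    ... | true | false | false = ⊥-elim (<ᵇ-refute y x eyx (ℕP.<-≤-trans (<ᵇ-sound y c eyc) (ℕP.≮⇒≥ (<ᵇ-refute x c exc))))

  -- For distinct letters x, y with parts u, v exactly one of
  -- u + [y < x] ≤ v ("x first") and v + [x < y] ≤ u ("y first") holds,
  -- because the two left-hand sides add up to u + v + 1.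
  module FirstLetter (x y u v : ℕ) (x≢y : ¬ x ≡ y) where

    order-bits : bit (y <ᵇ x) + bit (x <ᵇ y) ≡ 1
    order-bits with y <ᵇ x in e₁ | x <ᵇ y in e₂
    ... | true | true = ⊥-elim (ℕP.<-asym (<ᵇ-sound y x e₁) (<ᵇ-sound x y e₂))
    ... | true | false = refl
    ... | false | true = refl
    ... | false | false = ⊥-elim (x≢y (ℕP.≤-antisym (ℕP.≮⇒≥ (<ᵇ-refute y x e₁)) (ℕP.≮⇒≥ (<ᵇ-refute x y e₂))))

    tx ty : ℕ
    tx = u + bit (y <ᵇ x)
    ty = v + bit (x <ᵇ y)

    bounds-sum : tx + ty ≡ suc (v + u)
    bounds-sum = trans (solve 4 (λ u a v b → (u :+ a) :+ (v :+ b) := (v :+ u) :+ (a :+ b)) refl u (bit (y <ᵇ x)) v (bit (x <ᵇ y)))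
                       (trans (cong (v + u +_) order-bits) (ℕP.+-comm (v + u) 1))

    not-both : (tx ≤ᵇ v) ≡ true → (ty ≤ᵇ u) ≡ true → ⊥
    not-both e₁ e₂ = ℕP.<-irrefl refl (subst (_≤ v + u) bounds-sum (ℕP.+-mono-≤ (≤ᵇ-sound tx v e₁) (≤ᵇ-sound ty u e₂)))

    one-of : (tx ≤ᵇ v) ≡ false → (ty ≤ᵇ u) ≡ false → ⊥
    one-of e₁ e₂ = ≤ᵇ-refute ty u e₂ (ℕP.+-cancelʳ-≤ (suc v) ty u (subst (ty + suc v ≤_) (sym (ℕP.+-suc u v))
      (ℕP.≤-trans (ℕP.+-monoʳ-≤ ty (ℕP.≰⇒> (≤ᵇ-refute tx v e₁)))
        (ℕP.≤-reflexive (trans (ℕP.+-comm ty tx) (trans bounds-sum (cong suc (ℕP.+-comm v u))))))))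

  collect : ∀ P L x π (I : List (List ℕ)) (K : ℕ → List ℕ) →
    (∀ u → K u ↭ concatMap (G P (just (u , x))) I) →
    concatMap (λ u → keep (lowerBound L (x ∷ π) ≤ᵇ u) (map (u +_) (K u))) (upTo P) ↭ concatMap (G P L) (map (x ∷_) I)
  collect P L x π I K ih =
    ↭-trans (concatMap-cong-↭ (upTo P) (λ u → keep-↭ (lowerBound L (x ∷ π) ≤ᵇ u) (PP.map⁺ (u +_) (ih u))))
    (↭-trans (↭-reflexive (LP.concatMap-cong (λ u → trans (cong (keep (lowerBound L (x ∷ π) ≤ᵇ u)) (LP.map-concatMap (u +_) (G P (just (u , x))) I))
                                                (keep-concatMap (lowerBound L (x ∷ π) ≤ᵇ u) (λ τ → map (u +_) (G P (just (u , x)) τ)) I)) (upTo P)))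
    (↭-trans (concatMap-swap (λ u τ → keep (lowerBound L (x ∷ π) ≤ᵇ u) (map (u +_) (G P (just (u , x)) τ))) (upTo P) I)
    (↭-reflexive (trans (LP.concatMap-cong (λ τ → G-∷′ P L x π τ) I) (sym (LP.concatMap-map (G P L) (x ∷_) I))))))

  -- The inductive step for the words x ∷ π and y ∷ σ: expand both factors by
  -- their first parts u and v, and split the pairs (u, v) according to which
  -- of x and y comes first in the interleaving.
  module Step (P : ℕ) (L : Maybe (ℕ × ℕ)) (x : ℕ) (π : List ℕ) (y : ℕ) (σ : List ℕ) where

    U : List ℕ
    U = upTo P
    mx my : ℕ
    mx = lowerBound L (x ∷ π)
    my = lowerBound L (y ∷ σ)

    A : ℕ → List ℕ
    A u = map (u +_) (G P (just (u , x)) π)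
    B : ℕ → List ℕ
    B v = map (v +_) (G P (just (v , y)) σ)
    Z : ℕ → ℕ → List ℕ
    Z u v = A u ⊗ B v

    Xfirst Yfirst : ℕ → ℕ → List ℕ
    Xfirst u v = keep (mx ≤ᵇ u) (keep (u + bit (y <ᵇ x) ≤ᵇ v) (Z u v))
    Yfirst u v = keep (my ≤ᵇ v) (keep (v + bit (x <ᵇ y) ≤ᵇ u) (Z u v))

    distribute : ∀ u (b : ℕ → Bool) → A u ⊗ concatMap (λ v → keep (b v) (B v)) U ↭ concatMap (λ v → keep (b v) (Z u v)) U
    distribute u b = ↭-trans (⊗-concatMapʳ (λ v → keep (b v) (B v)) U (A u)) (↭-reflexive (LP.concatMap-cong (λ v → keep-⊗ʳ (b v) (A u) (B v)) U))

    expand : G P L (x ∷ π) ⊗ G P L (y ∷ σ) ↭ concatMap (λ u → concatMap (λ v → keep (mx ≤ᵇ u) (keep (my ≤ᵇ v) (Z u v))) U) U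
    expand =
      ↭-trans (↭-reflexive (trans (cong (_⊗ G P L (y ∷ σ)) (G-∷ P L x π))
                    (trans (⊗-concatMapˡ (λ u → keep (mx ≤ᵇ u) (A u)) U (G P L (y ∷ σ)))
                           (LP.concatMap-cong (λ u → keep-⊗ˡ (mx ≤ᵇ u) (A u) (G P L (y ∷ σ))) U))))
      (↭-trans (concatMap-cong-↭ U (λ u → keep-↭ (mx ≤ᵇ u) (↭-trans (↭-reflexive (cong (A u ⊗_) (G-∷ P L y σ))) (distribute u (λ v → my ≤ᵇ v)))))
      (↭-reflexive (LP.concatMap-cong (λ u → keep-concatMap (mx ≤ᵇ u) (λ v → keep (my ≤ᵇ v) (Z u v)) U) U)))

    split : ¬ x ≡ y → G P L (x ∷ π) ⊗ G P L (y ∷ σ) ↭ concatMap (λ u → concatMap (Xfirst u) U) U ++ concatMap (λ u → concatMap (Yfirst u) U) U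
    split x≢y = ↭-trans expand
      (↭-trans (concatMap-cong-↭ U (λ u → concatMap-cong-↭ U (λ v → split-keep _ _ _ _ (Z u v)
                   (bound-trans L x y π σ u v) (bound-trans L y x σ π v u) (FirstLetter.not-both x y u v x≢y) (FirstLetter.one-of x y u v x≢y))))
      (↭-trans (concatMap-cong-↭ U (λ u → concatMap-++-↭ (Xfirst u) (Yfirst u) U))
      (concatMap-++-↭ (λ u → concatMap (Xfirst u) U) (λ u → concatMap (Yfirst u) U) U)))

    x-first : (∀ u → G P (just (u , x)) π ⊗ G P (just (u , x)) (y ∷ σ) ↭ concatMap (G P (just (u , x))) (ilv π (y ∷ σ))) →
              concatMap (λ u → concatMap (Xfirst u) U) U ↭ concatMap (G P L) (map (x ∷_) (ilv π (y ∷ σ)))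
    x-first ih = ↭-trans (↭-reflexive (LP.concatMap-cong (λ u → sym (keep-concatMap (mx ≤ᵇ u) (λ v → keep (u + bit (y <ᵇ x) ≤ᵇ v) (Z u v)) U)) U))
      (↭-trans (concatMap-cong-↭ U (λ u → keep-↭ (mx ≤ᵇ u)
          (↭-trans (↭-sym (↭-trans (↭-reflexive (cong (A u ⊗_) (G-∷ P (just (u , x)) y σ))) (distribute u (λ v → u + bit (y <ᵇ x) ≤ᵇ v))))
                   (↭-reflexive (shift-⊗ˡ u (G P (just (u , x)) π) (G P (just (u , x)) (y ∷ σ)))))))
      (collect P L x π (ilv π (y ∷ σ)) (λ u → G P (just (u , x)) π ⊗ G P (just (u , x)) (y ∷ σ)) ih))

    y-first : (∀ v → G P (just (v , y)) (x ∷ π) ⊗ G P (just (v , y)) σ ↭ concatMap (G P (just (v , y))) (ilv (x ∷ π) σ)) →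
              concatMap (λ u → concatMap (Yfirst u) U) U ↭ concatMap (G P L) (map (y ∷_) (ilv (x ∷ π) σ))
    y-first ih = ↭-trans (concatMap-swap Yfirst U U)
      (↭-trans (↭-reflexive (LP.concatMap-cong (λ v → sym (keep-concatMap (my ≤ᵇ v) (λ u → keep (v + bit (x <ᵇ y) ≤ᵇ u) (Z u v)) U)) U))
      (↭-trans (↭-reflexive (LP.concatMap-cong (λ v → cong (keep (my ≤ᵇ v)) (factor v)) U))
      (collect P L y σ (ilv (x ∷ π) σ) (λ v → G P (just (v , y)) (x ∷ π) ⊗ G P (just (v , y)) σ) ih)))
      where
      factor : ∀ v → concatMap (λ u → keep (v + bit (x <ᵇ y) ≤ᵇ u) (Z u v)) U ≡ map (v +_) (G P (just (v , y)) (x ∷ π) ⊗ G P (just (v , y)) σ)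
      factor v = trans (sym (trans (⊗-concatMapˡ (λ u → keep (v + bit (x <ᵇ y) ≤ᵇ u) (A u)) U (B v)) (LP.concatMap-cong (λ u → keep-⊗ˡ (v + bit (x <ᵇ y) ≤ᵇ u) (A u) (B v)) U)))
                   (trans (cong (_⊗ B v) (sym (G-∷ P (just (v , y)) x π))) (shift-⊗ʳ v (G P (just (v , y)) (x ∷ π)) (G P (just (v , y)) σ)))

  fundamental : ∀ P L π σ → Disjoint π σ → G P L π ⊗ G P L σ ↭ concatMap (G P L) (ilv π σ)
  fundamental P L [] σ d = ↭-reflexive (trans (⊗-identityˡ (G P L σ)) (sym (LP.++-identityʳ _)))
  fundamental P L (x ∷ π) [] d = ↭-reflexive (trans (⊗-identityʳ _) (sym (LP.++-identityʳ _)))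
  fundamental P L (x ∷ π) (y ∷ σ) (x∉ ∷ d) =
    ↭-trans (split (λ e → x∉ (here e)))
    (↭-trans (PP.++⁺ (x-first (λ u → fundamental P (just (u , x)) π (y ∷ σ) d))
                     (y-first (λ v → fundamental P (just (v , y)) (x ∷ π) σ (disjoint-swap x∉ d))))
    (↭-reflexive (sym (LP.concatMap-++ (G P L) (map (x ∷_) (ilv π (y ∷ σ))) (map (y ∷_) (ilv (x ∷ π) σ))))))
    where open Step P L x π y σ

-- φB is multiplicative: φB[π] is the generating function of the
-- π-partitions (as a function of the bound p), so by the fundamental lemma
-- the product φB[π] φB[σ] is the sum of φB[τ] over the interleavings τ,
-- i.e. over the shuffle set S(π, σ).
module ModelB where

  open NatToRational
  open FiniteSums
  open CoefficientArrays
  open BooleanTests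
  open ShuffleSets
  open ExponentMultisets
  open GaussianMultisets
  open PPartitions
  open FundamentalLemma

  φB-coeff : ℕ → ℕ → ℕ → S2
  φB-coeff n d c p a = if c ≤ᵇ a then fromℕ (qbin (p + n ∸ 1 ∸ d) n (a ∸ c)) else 0ℚ

  φB-lift : ∀ n d c → φB (n , d , c) ≈ liftX n (φB-coeff n d c)
  φB-lift n d c = ≈-trans (⊛-cong (⊛-cong (monoB-X c 0) (≈-refl {qbinB n d})) (monoB-X 0 n))
    (≈-trans (⊛-cong (liftX-⊛ 0 0 (δ c) Qs) (≈-refl {liftX n (δ 0)}))
    (≈-trans (liftX-⊛ 0 n (δ c ⋆ Qs) (δ 0)) (liftX-cong n (λ m a → trans (⋆δ0 (δ c ⋆ Qs) m a) (δ⋆ c Qs m a)))))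
    where
    Qs : S2
    Qs p a = fromℕ (qbin (p + n ∸ 1 ∸ d) n a)

  cnt-⊗ : ∀ a A B → fromℕ (cnt a (A ⊗ B)) ≡ Σ≤ a (λ i → fromℕ (cnt i A) ℚ.* fromℕ (cnt (a ∸ i) B))
  cnt-⊗ a [] B = sym (Σ-0 a _ (λ i _ → ℚP.*-zeroˡ (fromℕ (cnt (a ∸ i) B))))
  cnt-⊗ a (x ∷ A) B = trans (cong fromℕ (cnt-++ a (map (x +_) B) (A ⊗ B))) (trans (fromℕ-+ (cnt a (map (x +_) B)) (cnt a (A ⊗ B)))
    (trans (cong₂ ℚ._+_ head (cnt-⊗ a A B))
    (trans (sym (Σ-+ a T _)) (Σ-cong a (λ i _ → trans (sym (ℚP.*-distribʳ-+ (fromℕ (cnt (a ∸ i) B)) (fromℕ (if x ≡ᵇ i then 1 else 0)) (fromℕ (cnt i A))))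
         (cong (ℚ._* fromℕ (cnt (a ∸ i) B)) (sym (fromℕ-+ (if x ≡ᵇ i then 1 else 0) (cnt i A)))))))))
    where
    T : ℕ → ℚ
    T i = fromℕ (if x ≡ᵇ i then 1 else 0) ℚ.* fromℕ (cnt (a ∸ i) B)
    T-off : ∀ i → ¬ i ≡ x → T i ≡ 0ℚ
    T-off i i≢ = trans (cong (λ z → fromℕ z ℚ.* fromℕ (cnt (a ∸ i) B)) (if-false (≡ᵇ-false x i (λ e → i≢ (sym e))))) (ℚP.*-zeroˡ (fromℕ (cnt (a ∸ i) B)))
    head : fromℕ (cnt a (map (x +_) B)) ≡ Σ≤ a T
    head with x ℕP.≤? a
    ... | yes x≤a = trans (cong fromℕ (trans (cnt-shift x a B) (if-true (≤ᵇ-true x a x≤a))))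
           (sym (trans (Σ-single a x T x≤a (λ i _ → T-off i)) (trans (cong (λ z → fromℕ z ℚ.* fromℕ (cnt (a ∸ x) B)) (if-true (≡ᵇ-true x x refl))) (ℚP.*-identityˡ (fromℕ (cnt (a ∸ x) B))))))
    ... | no x≰a = trans (cong fromℕ (trans (cnt-shift x a B) (if-false (≤ᵇ-false x a x≰a))))
           (sym (Σ-0 a T (λ i i≤a → T-off i (λ e → x≰a (subst (_≤ a) e i≤a)))))

  genFun : List ℕ → S2
  genFun w P a = fromℕ (cnt a (G P nothing w))

  sumE-genFun : ∀ n l → sumE (map (λ τ → liftX n (genFun τ)) l) ≈ liftX n (λ P a → fromℕ (cnt a (concatMap (G P nothing) l)))
  sumE-genFun n [] m a b with b ≡ᵇ n
  ... | true = refl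
  ... | false = refl
  sumE-genFun n (τ ∷ l) = ≈-trans (λ m a b → cong (liftX n (genFun τ) m a b ℚ.+_) (sumE-genFun n l m a b))
     (≈-trans (liftX-⊕ n (genFun τ) (λ P a → fromℕ (cnt a (concatMap (G P nothing) l))))
     (liftX-cong n (λ P a → trans (sym (fromℕ-+ (cnt a (G P nothing τ)) (cnt a (concatMap (G P nothing) l)))) (cong fromℕ (sym (cnt-++ a (G P nothing τ) (concatMap (G P nothing) l)))))))

  qbin-small : ∀ N k a → N < k → qbin N k a ≡ 0
  qbin-small N k a lt = trans (sym (cnt-QB N k a)) (cong (cnt a) (QB-small N k lt))

  -- the truncated subtraction in Defs' φB agrees with the closed form: both
  -- sides vanish when d > p
  qbin-arg : ∀ p n′ d A → qbin (p + suc n′ ∸ 1 ∸ d) (suc n′) A ≡ qbin ((p ∸ d) + n′) (suc n′) A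
  qbin-arg p n′ d A rewrite ℕP.+-suc p n′ with d ℕP.≤? p
  ... | yes d≤p = cong (λ z → qbin z (suc n′) A) (ℕP.+-∸-comm n′ d≤p)
  ... | no d≰p = trans (qbin-small _ (suc n′) A (s≤s small)) (sym (qbin-small _ (suc n′) A (s≤s (ℕP.≤-reflexive (cong (_+ n′) (ℕP.m≤n⇒m∸n≡0 (ℕP.<⇒≤ (ℕP.≰⇒> d≰p))))))))
    where
    small : p + n′ ∸ d ≤ n′
    small = ℕP.≤-trans (ℕP.∸-monoˡ-≤ d (ℕP.+-monoˡ-≤ n′ (ℕP.<⇒≤ (ℕP.≰⇒> d≰p)))) (ℕP.≤-reflexive (ℕP.m+n∸m≡n d n′))

  φB-genFun : ∀ w → φB (cls w) ≈ liftX (length w) (genFun w)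
  φB-genFun w = ≈-trans (φB-lift (length w) (des w) (comaj w)) (liftX-cong (length w) (coeff w))
    where
    coeff : ∀ w → φB-coeff (length w) (des w) (comaj w) ≈S genFun w
    coeff [] p a = cong fromℕ (trans (sym (cnt-QB (p + 0 ∸ 1 ∸ 0) 0 (a ∸ 0))) (cong (cnt a) (QB-0 (p + 0 ∸ 1 ∸ 0))))
    coeff (x ∷ w′) p a = sym (trans (cong fromℕ (trans (cnt-↭ a (closedForm p x w′ 0)) (cnt-shift (comaj (x ∷ w′)) a Q)))
       (shifted (comaj (x ∷ w′) ≤ᵇ a)))
      where
      Q : List ℕ
      Q = QB ((p ∸ des (x ∷ w′)) + length w′) (suc (length w′))
      shifted : ∀ b → fromℕ (if b then cnt (a ∸ comaj (x ∷ w′)) Q else 0)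
                   ≡ (if b then fromℕ (qbin (p + suc (length w′) ∸ 1 ∸ des (x ∷ w′)) (suc (length w′)) (a ∸ comaj (x ∷ w′))) else 0ℚ)
      shifted true = cong fromℕ (trans (cnt-QB ((p ∸ des (x ∷ w′)) + length w′) (suc (length w′)) (a ∸ comaj (x ∷ w′))) (sym (qbin-arg p (length w′) (des (x ∷ w′)) (a ∸ comaj (x ∷ w′)))))
      shifted false = refl

  φB-multiplicative : ∀ π σ → IsPerm π → IsPerm σ → Disjoint π σ → (φB (cls π) ⊛ φB (cls σ)) ≈ sumE (map (φB ∘ cls) (shuffles π σ))
  φB-multiplicative π σ pπ pσ d =
    ≈-trans (⊛-cong (φB-genFun π) (φB-genFun σ))
    (≈-trans (liftX-⊛ n₁ n₂ (genFun π) (genFun σ))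
    (≈-trans (liftX-cong (n₁ + n₂) (λ P a → trans (sym (cnt-⊗ a (G P nothing π) (G P nothing σ))) (cong fromℕ (cnt-↭ a (fundamental P nothing π σ d)))))
    (≈-trans (≈-sym (sumE-genFun (n₁ + n₂) (ilv π σ)))
    (≈-trans (sumE-cong (λ τ → liftX (n₁ + n₂) (genFun τ)) (φB ∘ cls) (ilv π σ) (All.tabulate (λ {τ} m → ≈-sym (ilv-term τ m))))
             (sumE-↭ (φB ∘ cls) (↭-sym (shuffles-↭-ilv π σ pπ pσ d)))))))
    where
    n₁ n₂ : ℕ
    n₁ = length π
    n₂ = length σ
    ilv-term : ∀ τ → τ ∈ ilv π σ → φB (cls τ) ≈ liftX (n₁ + n₂) (genFun τ)
    ilv-term τ m = subst (λ k → φB (cls τ) ≈ liftX k (genFun τ)) (ilv-length π σ m) (φB-genFun τ)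

-- Necessity by induction on π (a descent at the front raises comaj by
-- |π| - 1); sufficiency by prepending a new smallest or largest letter.
module DescentComajRange where

  open ℕ-Solver using (solve; _:+_; _:*_; _:=_; con)
  open PPartitions

  tri : ℕ → ℕ
  tri j = suc j C 2

  tri-suc : ∀ j → tri (suc j) ≡ tri j + suc j
  tri-suc j = trans (sym (nCk+nC[k+1]≡[n+1]C[k+1] (suc j) 1)) (trans (cong (_+ tri j) (nC1≡n (suc j))) (ℕP.+-comm (suc j) (tri j)))

  tri-double : ∀ j → tri j + tri j ≡ j ℕ.* suc j
  tri-double zero = refl
  tri-double (suc j) rewrite tri-suc j = trans (regroup (tri j) j) (trans (cong (λ z → z + suc j + suc j) (tri-double j)) (solve 1 (λ j → j :* (con 1 :+ j) :+ (con 1 :+ j) :+ (con 1 :+ j) := (con 1 :+ j) :* (con 2 :+ j)) refl j))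
    where
    regroup : ∀ t j → t + suc j + (t + suc j) ≡ t + t + suc j + suc j
    regroup t j = solve 2 (λ t j → t :+ (con 1 :+ j) :+ (t :+ (con 1 :+ j)) := t :+ t :+ (con 1 :+ j) :+ (con 1 :+ j)) refl t j

  InRange : ℕ → ℕ → ℕ → Set
  InRange n j k = suc j ≤ n × tri j ≤ k × k + tri j ≤ n ℕ.* j

  InRange-grow : ∀ n j k → InRange n j k → InRange (suc n) j k
  InRange-grow n j k (a , b , c) = ℕP.m≤n⇒m≤1+n a , b , ℕP.≤-trans c (ℕP.m≤n+m (n ℕ.* j) j)

  -- a front descent raises des by one and comaj by the old length
  InRange-grow-descent : ∀ n j k → InRange n j k → InRange (suc n) (suc j) (k + n)
  InRange-grow-descent n j k (a , b , c) = s≤s a , ℕP.≤-trans (ℕP.≤-reflexive (tri-suc j)) (ℕP.+-mono-≤ b a) ,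
    ℕP.≤-trans (ℕP.≤-reflexive (cong (k + n +_) (tri-suc j)))
    (ℕP.≤-trans (ℕP.≤-reflexive (e1 k n (tri j) j)) (ℕP.≤-trans (ℕP.+-monoˡ-≤ (n + suc j) c) (ℕP.≤-reflexive (e2 n j))))
    where
    e1 : ∀ k n t j → k + n + (t + suc j) ≡ k + t + (n + suc j)
    e1 = solve 4 (λ k n t j → k :+ n :+ (t :+ (con 1 :+ j)) := k :+ t :+ (n :+ (con 1 :+ j))) refl
    e2 : ∀ n j → n ℕ.* j + (n + suc j) ≡ suc n ℕ.* suc j
    e2 = solve 2 (λ n j → n :* j :+ (n :+ (con 1 :+ j)) := (con 1 :+ n) :* (con 1 :+ j)) refl

  private
    upper-bound : ∀ n j k → k + tri (suc j) ≤ suc n ℕ.* suc j → k + tri j ≤ n + n ℕ.* j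
    upper-bound n j k c = ℕP.+-cancelʳ-≤ (suc j) _ _ (ℕP.≤-trans (ℕP.≤-reflexive (e k (tri j) j)) (ℕP.≤-trans (subst (λ z → k + z ≤ suc n ℕ.* suc j) (tri-suc j) c) (ℕP.≤-reflexive (e′ n j))))
      where
      e : ∀ k t j → k + t + suc j ≡ k + (t + suc j)
      e = solve 3 (λ k t j → k :+ t :+ (con 1 :+ j) := k :+ (t :+ (con 1 :+ j))) refl
      e′ : ∀ n j → suc n ℕ.* suc j ≡ n + n ℕ.* j + suc j
      e′ = solve 2 (λ n j → (con 1 :+ n) :* (con 1 :+ j) := n :+ n :* j :+ (con 1 :+ j)) refl

    InRange-minus : ∀ n j k → suc j ≤ n → tri j + n ≤ k → k + tri j ≤ n + n ℕ.* j → n ≤ k × InRange n j (k ∸ n)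
    InRange-minus n j k a lo up = n≤k , a , ℕP.m+n≤o⇒m≤o∸n (tri j) lo ,
      ℕP.+-cancelʳ-≤ n _ _ (ℕP.≤-trans (ℕP.≤-reflexive (trans (e (k ∸ n) (tri j) n) (cong (_+ tri j) (ℕP.m∸n+n≡m n≤k)))) (ℕP.≤-trans up (ℕP.≤-reflexive (ℕP.+-comm n (n ℕ.* j)))))
      where
      n≤k : n ≤ k
      n≤k = ℕP.≤-trans (ℕP.m≤n+m n (tri j)) lo
      e : ∀ a t n → a + t + n ≡ a + n + t
      e = solve 3 (λ a t n → a :+ t :+ n := a :+ n :+ t) refl

    lower-bound : ∀ n j k → suc (suc j) ≤ n → ¬ (k + tri (suc j) ≤ n ℕ.* suc j) → tri j + n ≤ k
    lower-bound n j k a′ nc with tri j + n ℕP.≤? k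
    ... | yes p = p
    ... | no np = ⊥-elim (nc (ℕP.≤-trans (ℕP.≤-reflexive (e1 k (tri j) j)) (ℕP.≤-trans (ℕP.+-monoˡ-≤ (tri j + j) (ℕP.≰⇒> np))
          (ℕP.≤-trans (ℕP.≤-reflexive (trans (e2 (tri j) n j) (cong (λ z → n + z + j) (tri-double j))))
          (ℕP.≤-trans (ℕP.≤-reflexive (e3 n j)) (ℕP.≤-trans (ℕP.+-monoʳ-≤ n (ℕP.*-monoʳ-≤ j a′)) (ℕP.≤-reflexive (e4 n j))))))))
      where
      e1 : ∀ k t j → k + tri (suc j) ≡ suc k + (tri j + j)
      e1 k t j = trans (cong (k +_) (tri-suc j)) (solve 3 (λ k t j → k :+ (t :+ (con 1 :+ j)) := con 1 :+ k :+ (t :+ j)) refl k (tri j) j)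
      e2 : ∀ t n j → t + n + (t + j) ≡ n + (t + t) + j
      e2 = solve 3 (λ t n j → t :+ n :+ (t :+ j) := n :+ (t :+ t) :+ j) refl
      e3 : ∀ n j → n + j ℕ.* suc j + j ≡ n + j ℕ.* suc (suc j)
      e3 = solve 2 (λ n j → n :+ j :* (con 1 :+ j) :+ j := n :+ j :* (con 2 :+ j)) refl
      e4 : ∀ n j → n + j ℕ.* n ≡ n ℕ.* suc j
      e4 = solve 2 (λ n j → n :+ j :* n := n :* (con 1 :+ j)) refl

  InRange-shrink : ∀ n j k → 1 ≤ n → InRange (suc n) j k → InRange n j k ⊎ Σ ℕ (λ j′ → j ≡ suc j′ × n ≤ k × InRange n j′ (k ∸ n))
  InRange-shrink n zero k 1≤n (a , b , c) = inj₁ (1≤n , b , ℕP.≤-trans c (ℕP.≤-reflexive (trans (ℕP.*-zeroʳ (suc n)) (sym (ℕP.*-zeroʳ n)))))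
  InRange-shrink n (suc j) k 1≤n (s≤s a , b , c) with suc (suc j) ℕP.≤? n | k + tri (suc j) ℕP.≤? n ℕ.* suc j
  ... | yes a′ | yes c′ = inj₁ (a′ , b , c′)
  ... | no na | _ = inj₂ (j , refl , InRange-minus n j k a b′ (upper-bound n j k c))
    where
    n≡ : n ≡ suc j
    n≡ = ℕP.≤-antisym (ℕP.≤-pred (ℕP.≰⇒> na)) a
    b′ : tri j + n ≤ k
    b′ = subst (λ z → tri j + z ≤ k) (sym n≡) (subst (_≤ k) (tri-suc j) b)
  ... | yes a′ | no nc = inj₂ (j , refl , InRange-minus n j k a (lower-bound n j k a′ nc) (upper-bound n j k c))

  word-InRange : ∀ x w → InRange (length (x ∷ w)) (des (x ∷ w)) (comaj (x ∷ w))
  word-InRange x [] = s≤s z≤n , z≤n , z≤n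
  word-InRange x (y ∷ w) rewrite des-∷ x (y ∷ w) | comaj-∷ x (y ∷ w) with y <ᵇ x
  ... | true = subst (InRange (suc (length (y ∷ w))) (suc (des (y ∷ w)))) (trans (ℕP.+-comm (comaj (y ∷ w)) (length (y ∷ w))) (cong (_+ comaj (y ∷ w)) (sym (ℕP.*-identityˡ (length (y ∷ w))))))
                   (InRange-grow-descent (length (y ∷ w)) (des (y ∷ w)) (comaj (y ∷ w)) (word-InRange y w))
  ... | false = InRange-grow (length (y ∷ w)) (des (y ∷ w)) (comaj (y ∷ w)) (word-InRange y w)

  Target⇒InRange : ∀ n j k → Target (suc n , j , k) → InRange (suc n) j k
  Target⇒InRange n j k (inj₁ (() , _))
  Target⇒InRange n j k (inj₂ (_ , a , b , c)) = s≤s a , b , ℕP.≤-trans (ℕP.+-monoˡ-≤ (tri j) c) (ℕP.≤-reflexive (ℕP.m∸n+n≡m t≤))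
    where
    t≤ : tri j ≤ suc n ℕ.* j
    t≤ = ℕP.≤-trans b (ℕP.≤-trans c (ℕP.m∸n≤m _ (tri j)))

  InRange⇒Target : ∀ n j k → InRange (suc n) j k → Target (suc n , j , k)
  InRange⇒Target n j k (s≤s a , b , c) = inj₂ (s≤s z≤n , a , b , ℕP.≤-trans (ℕP.≤-reflexive (sym (ℕP.m+n∸n≡m k (tri j)))) (ℕP.∸-monoˡ-≤ (tri j) c))

  Achieved⇒Target : ∀ i → Achieved i → Target i
  Achieved⇒Target (.0 , .0 , .0) ([] , _ , refl , refl , refl) = inj₁ (refl , refl , refl)
  Achieved⇒Target (.(suc (length w)) , .(des (x ∷ w)) , .(comaj (x ∷ w))) (x ∷ w , _ , refl , refl , refl) = InRange⇒Target (length w) _ _ (word-InRange x w)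

  -- des and comaj only depend on the relative order of the letters
  descentsFrom-map-suc : ∀ i l → descentsFrom i (map suc l) ≡ descentsFrom i l
  descentsFrom-map-suc i [] = refl
  descentsFrom-map-suc i (x ∷ []) = refl
  descentsFrom-map-suc i (x ∷ y ∷ l) with y <ᵇ x | descentsFrom-map-suc (suc i) (y ∷ l)
  ... | true | ih = cong (i ∷_) ih
  ... | false | ih = ih

  des-map-suc : ∀ l → des (map suc l) ≡ des l
  des-map-suc l = cong length (descentsFrom-map-suc 1 l)

  comaj-map-suc : ∀ l → comaj (map suc l) ≡ comaj l
  comaj-map-suc l = trans (cong (λ D → sum (map (λ i → length (map suc l) ∸ i) D)) (descentsFrom-map-suc 1 l))
                      (cong (λ L → sum (map (λ i → L ∸ i) (descentsFrom 1 l))) (LP.length-map suc l))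

  ∈⇒≤sum : ∀ {y} l → y ∈ l → y ≤ sum l
  ∈⇒≤sum (x ∷ l) (here refl) = ℕP.m≤m+n x (sum l)
  ∈⇒≤sum (x ∷ l) (there m) = ℕP.≤-trans (∈⇒≤sum l m) (ℕP.m≤n+m (sum l) x)

  prepend-min : ∀ π → IsPerm π → IsPerm (1 ∷ map suc π) × des (1 ∷ map suc π) ≡ des π × comaj (1 ∷ map suc π) ≡ comaj π
  prepend-min π (u , pos) =
    (AllP.map⁺ (All.map (λ 0<y e → ℕP.<-irrefl (ℕP.suc-injective e) 0<y) pos) ∷ AllPairsP.map⁺ (AllPairs.map (λ ne e → ne (ℕP.suc-injective e)) u) ,
     s≤s z≤n ∷ AllP.map⁺ (All.tabulate (λ _ → s≤s z≤n))) ,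
    trans (des-∷ 1 (map suc π)) (cong₂ _+_ (no-descent π) (des-map-suc π)) ,
    trans (comaj-∷ 1 (map suc π)) (cong₂ (λ a b → a ℕ.* length (map suc π) + b) (no-descent π) (comaj-map-suc π))
    where
    no-descent : ∀ l → desHead 1 (map suc l) ≡ 0
    no-descent [] = refl
    no-descent (y ∷ l) = refl

  prepend-max : ∀ π → IsPerm π → 1 ≤ length π →
    IsPerm (suc (sum π) ∷ π) × des (suc (sum π) ∷ π) ≡ suc (des π) × comaj (suc (sum π) ∷ π) ≡ length π + comaj π
  prepend-max π (u , pos) nonempty =
    (All.tabulate (λ m e → ℕP.n≮n (sum π) (subst (_≤ sum π) (sym e) (∈⇒≤sum π m))) ∷ u , s≤s z≤n ∷ pos) ,
    trans (des-∷ (suc (sum π)) π) (cong (_+ des π) (descent π nonempty)) ,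
    trans (comaj-∷ (suc (sum π)) π) (trans (cong (λ a → a ℕ.* length π + comaj π) (descent π nonempty)) (cong (_+ comaj π) (ℕP.*-identityˡ (length π))))
    where
    descent : ∀ l → 1 ≤ length l → desHead (suc (sum l)) l ≡ 1
    descent (y ∷ l) _ = if-true (<ᵇ-true y (suc (y + sum l)) (s≤s (ℕP.m≤m+n y (sum l))))
      where open BooleanTests

  realize : ∀ n j k → InRange (suc n) j k → Achieved (suc n , j , k)
  realize zero zero zero t = 1 ∷ [] , ([] ∷ [] , s≤s z≤n ∷ []) , refl , refl , refl
  realize zero (suc j) k (s≤s () , _ , _)
  realize zero zero (suc k) (_ , _ , ())
  realize (suc n) j k t with InRange-shrink (suc n) j k (s≤s z≤n) t
  ... | inj₁ t′ with realize n j k t′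
  ...   | π , pπ , lπ , dπ , cπ with prepend-min π pπ
  ...     | p , d , c = 1 ∷ map suc π , p , cong suc (trans (LP.length-map suc π) lπ) , trans d dπ , trans c cπ
  realize (suc n) .(suc j′) k t | inj₂ (j′ , refl , n≤k , t′) with realize n j′ (k ∸ suc n) t′
  ... | π , pπ , lπ , dπ , cπ with prepend-max π pπ (subst (1 ≤_) (sym lπ) (s≤s z≤n))
  ...   | p , d , c = suc (sum π) ∷ π , p , cong suc lπ , trans d (cong suc dπ) , trans c (trans (cong₂ _+_ lπ cπ) (ℕP.m+[n∸m]≡n n≤k))

  Target⇒Achieved : ∀ i → Target i → Achieved i
  Target⇒Achieved (zero , .0 , .0) (inj₁ (refl , refl , refl)) = [] , ([] , []) , refl , refl , refl
  Target⇒Achieved (zero , j , k) (inj₂ (() , _))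
  Target⇒Achieved (suc n , j , k) t = realize n j k (Target⇒InRange n j k t)

  Achieved-empty : ∀ n j k → Achieved (n , j , k) → n ≡ 0 → j ≡ 0
  Achieved-empty n j k a n0 with Achieved⇒Target _ a
  ... | inj₁ (_ , j0 , _) = j0
  ... | inj₂ (1≤n , _) = ⊥-elim (ℕP.<-irrefl (sym n0) 1≤n)

-- Formal linear combinations Σ c_i [i] of class indices, given as lists of
-- pairs (c_i, i); the same index may occur several times.  weighted l h
-- evaluates the combination at h, and weighted l (δI i) is the total
-- coefficient of the index i.
module FormalCombinations where

  open ℚ-Solver using (solve; _:+_; _:*_; _:=_; con)

  _≟I_ : (i i′ : Idx) → Dec (i ≡ i′)
  _≟I_ = ProdP.≡-dec ℕ._≟_ (ProdP.≡-dec ℕ._≟_ ℕ._≟_)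

  δI : Idx → Idx → ℚ
  δI i i′ = if ⌊ i′ ≟I i ⌋ then 1ℚ else 0ℚ

  δI-self : ∀ i → δI i i ≡ 1ℚ
  δI-self i with i ≟I i
  ... | yes _ = refl
  ... | no ne = ⊥-elim (ne refl)

  δI-ne : ∀ i i′ → ¬ i′ ≡ i → δI i i′ ≡ 0ℚ
  δI-ne i i′ ne with i′ ≟I i
  ... | yes e = ⊥-elim (ne e)
  ... | no _ = refl

  weighted : List (ℚ × Idx) → (Idx → ℚ) → ℚ
  weighted [] h = 0ℚ
  weighted ((c , i) ∷ l) h = c ℚ.* h i ℚ.+ weighted l h

  IsRelation : (Idx → E) → List (ℚ × Idx) → Set
  IsRelation φ l = lincomb (map (λ ci → proj₁ ci , φ (proj₂ ci)) l) ≈ 0E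

  lincomb-eval : ∀ (φ : Idx → E) l m a b → lincomb (map (λ ci → proj₁ ci , φ (proj₂ ci)) l) m a b ≡ weighted l (λ i → φ i m a b)
  lincomb-eval φ [] m a b = refl
  lincomb-eval φ ((c , i) ∷ l) m a b = cong (c ℚ.* φ i m a b ℚ.+_) (lincomb-eval φ l m a b)

  weighted-+ : ∀ l h h′ → weighted l (λ i → h i ℚ.+ h′ i) ≡ weighted l h ℚ.+ weighted l h′
  weighted-+ [] h h′ = sym (ℚP.+-identityˡ 0ℚ)
  weighted-+ ((c , i) ∷ l) h h′ = trans (cong₂ ℚ._+_ (ℚP.*-distribˡ-+ c (h i) (h′ i)) (weighted-+ l h h′))
    (solve 4 (λ a b x y → (a :+ b) :+ (x :+ y) := (a :+ x) :+ (b :+ y)) refl (c ℚ.* h i) (c ℚ.* h′ i) (weighted l h) (weighted l h′))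

  weighted-++ : ∀ l₁ l₂ h → weighted (l₁ ++ l₂) h ≡ weighted l₁ h ℚ.+ weighted l₂ h
  weighted-++ [] l₂ h = sym (ℚP.+-identityˡ (weighted l₂ h))
  weighted-++ ((c , i) ∷ l₁) l₂ h = trans (cong (c ℚ.* h i ℚ.+_) (weighted-++ l₁ l₂ h)) (sym (ℚP.+-assoc (c ℚ.* h i) (weighted l₁ h) (weighted l₂ h)))

  weighted-cong : ∀ l h h′ → All (λ ci → h (proj₂ ci) ≡ h′ (proj₂ ci)) l → weighted l h ≡ weighted l h′
  weighted-cong [] h h′ _ = refl
  weighted-cong ((c , i) ∷ l) h h′ (e ∷ es) = cong₂ ℚ._+_ (cong (c ℚ.*_) e) (weighted-cong l h h′ es)

  weighted-0 : ∀ l → weighted l (λ _ → 0ℚ) ≡ 0ℚ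
  weighted-0 [] = refl
  weighted-0 ((c , i) ∷ l) = trans (cong₂ ℚ._+_ (ℚP.*-zeroʳ c) (weighted-0 l)) (ℚP.+-identityˡ 0ℚ)

  dropIndex : Idx → List (ℚ × Idx) → List (ℚ × Idx)
  dropIndex i₀ [] = []
  dropIndex i₀ ((c , i) ∷ l) = if ⌊ i ≟I i₀ ⌋ then dropIndex i₀ l else (c , i) ∷ dropIndex i₀ l

  dropIndex-length : ∀ i₀ l → length (dropIndex i₀ l) ≤ length l
  dropIndex-length i₀ [] = z≤n
  dropIndex-length i₀ ((c , i) ∷ l) with i ≟I i₀
  ... | yes _ = ℕP.m≤n⇒m≤1+n (dropIndex-length i₀ l)
  ... | no _ = s≤s (dropIndex-length i₀ l)

  dropIndex-head-length : ∀ c i₀ l → length (dropIndex i₀ ((c , i₀) ∷ l)) ≤ length l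
  dropIndex-head-length c i₀ l with i₀ ≟I i₀
  ... | yes _ = dropIndex-length i₀ l
  ... | no ne = ⊥-elim (ne refl)

  weighted-split : ∀ i₀ h l → weighted l h ≡ h i₀ ℚ.* weighted l (δI i₀) ℚ.+ weighted (dropIndex i₀ l) h
  weighted-split i₀ h [] = sym (trans (cong (ℚ._+ 0ℚ) (ℚP.*-zeroʳ (h i₀))) (ℚP.+-identityˡ 0ℚ))
  weighted-split i₀ h ((c , i) ∷ l) with i ≟I i₀
  ... | yes refl = trans (cong (c ℚ.* h i ℚ.+_) (weighted-split i h l))
       (solve 4 (λ c x A R → c :* x :+ (x :* A :+ R) := x :* (c :* con 1ℚ :+ A) :+ R) refl c (h i) (weighted l (δI i)) (weighted (dropIndex i l) h))
  ... | no _ = trans (cong (c ℚ.* h i ℚ.+_) (weighted-split i₀ h l))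
       (solve 5 (λ c y x A R → c :* y :+ (x :* A :+ R) := x :* (c :* con 0ℚ :+ A) :+ (c :* y :+ R)) refl c (h i) (h i₀) (weighted l (δI i₀)) (weighted (dropIndex i₀ l) h))

  dropIndex-same : ∀ i₀ l → weighted (dropIndex i₀ l) (δI i₀) ≡ 0ℚ
  dropIndex-same i₀ [] = refl
  dropIndex-same i₀ ((c , i) ∷ l) with i ≟I i₀
  ... | yes _ = dropIndex-same i₀ l
  ... | no ne = trans (cong₂ ℚ._+_ (trans (cong (c ℚ.*_) (δI-ne i₀ i ne)) (ℚP.*-zeroʳ c)) (dropIndex-same i₀ l)) (ℚP.+-identityˡ 0ℚ)

  dropIndex-other : ∀ i₀ i l → ¬ i ≡ i₀ → weighted (dropIndex i₀ l) (δI i) ≡ weighted l (δI i)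
  dropIndex-other i₀ i [] ne = refl
  dropIndex-other i₀ i ((c , i′) ∷ l) ne with i′ ≟I i₀
  ... | yes refl = trans (dropIndex-other i₀ i l ne) (sym (trans (cong (ℚ._+ weighted l (δI i)) (trans (cong (c ℚ.*_) (δI-ne i i′ (λ e → ne (sym e)))) (ℚP.*-zeroʳ c))) (ℚP.+-identityˡ _)))
  ... | no _ = cong (c ℚ.* δI i i′ ℚ.+_) (dropIndex-other i₀ i l ne)

  weighted-restrict : ∀ (P : Idx → Bool) N l → length l ≤ N → (∀ i → P i ≡ true → weighted l (δI i) ≡ 0ℚ) →
    ∀ (h : Idx → ℚ) → weighted l (λ i → if P i then h i else 0ℚ) ≡ 0ℚ
  weighted-restrict P N [] _ _ h = refl
  weighted-restrict P (suc N) ((c , i₀) ∷ l) (s≤s len) hyp h =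
    trans (weighted-split i₀ h′ ((c , i₀) ∷ l)) (trans (cong₂ ℚ._+_ first rest) (ℚP.+-identityˡ 0ℚ))
    where
    h′ : Idx → ℚ
    h′ i = if P i then h i else 0ℚ
    first : h′ i₀ ℚ.* weighted ((c , i₀) ∷ l) (δI i₀) ≡ 0ℚ
    first with P i₀ in e
    ... | true = trans (cong (h i₀ ℚ.*_) (hyp i₀ e)) (ℚP.*-zeroʳ (h i₀))
    ... | false = ℚP.*-zeroˡ (weighted ((c , i₀) ∷ l) (δI i₀))
    rest : weighted (dropIndex i₀ ((c , i₀) ∷ l)) h′ ≡ 0ℚ
    rest = weighted-restrict P N (dropIndex i₀ ((c , i₀) ∷ l)) (ℕP.≤-trans (dropIndex-head-length c i₀ l) len) hyp′ h
      where
      hyp′ : ∀ i → P i ≡ true → weighted (dropIndex i₀ ((c , i₀) ∷ l)) (δI i) ≡ 0ℚ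
      hyp′ i e with i ≟I i₀
      ... | yes refl = dropIndex-same i ((c , i) ∷ l)
      ... | no ne = trans (dropIndex-other i₀ i ((c , i₀) ∷ l) ne) (hyp i e)

  coefficients-vanish : ∀ l → (∀ i → weighted l (δI i) ≡ 0ℚ) → AllPairs _≢_ (map proj₂ l) → All (λ ci → proj₁ ci ≡ 0ℚ) l
  coefficients-vanish [] _ _ = []
  coefficients-vanish ((c , i) ∷ l) z (ai ∷ ap) = c0 ∷ coefficients-vanish l z′ ap
    where
    rest0 : weighted l (δI i) ≡ 0ℚ
    rest0 = trans (weighted-cong l (δI i) (λ _ → 0ℚ) (lem l ai)) (weighted-0 l)
      where
      lem : ∀ l → All (i ≢_) (map proj₂ l) → All (λ ci → δI i (proj₂ ci) ≡ 0ℚ) l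
      lem [] _ = []
      lem ((c′ , i′) ∷ l) (ne ∷ as) = δI-ne i i′ (λ e → ne (sym e)) ∷ lem l as
    c0 : c ≡ 0ℚ
    c0 = trans (sym (ℚP.*-identityʳ c)) (trans (cong (c ℚ.*_) (sym (δI-self i))) (trans (sym (ℚP.+-identityʳ _)) (trans (cong (c ℚ.* δI i i ℚ.+_) (sym rest0)) (z i))))
    z′ : ∀ i′ → weighted l (δI i′) ≡ 0ℚ
    z′ i′ = trans (sym (ℚP.+-identityˡ _)) (trans (cong (ℚ._+ weighted l (δI i′)) (sym (trans (cong (ℚ._* δI i′ i) c0) (ℚP.*-zeroˡ (δI i′ i))))) (z i′))

-- Linear independence of the φB-images of distinct classes, by a triangular
-- argument: evaluated at p = J + 1, φB(n, j, k) vanishes for j > J (the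
-- q-binomial has too small a top index) and is q^k x^n for j = J.
module Independence where

  open BooleanTests
  open GaussianMultisets using (QB; cnt; cnt-QB; QB-small; QB-diagonal)
  open ModelB using (φB-lift; φB-coeff)
  open DescentComajRange using (Achieved-empty)
  open FormalCombinations

  desOf : Idx → ℕ
  desOf (n , j , k) = j

  shift-∸ : ∀ J n → J + n ∸ suc J ≡ n ∸ 1
  shift-∸ zero n = refl
  shift-∸ (suc J) n = shift-∸ J n

  sucpred : ∀ n → 1 ≤ n → suc (n ∸ 1) ≡ n
  sucpred (suc n) _ = refl

  -- They are opaque so that
  -- the later arguments never unfold the arrays of Defs.
  opaque
    φB-at : ℕ → ℕ → ℕ → ℕ → ℕ → ℚ
    φB-at n j′ k′ J k = φB-coeff n j′ k′ (suc J) k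

    φB-value : Idx → ℕ → ℕ → ℕ → ℚ
    φB-value i J k n = φB i (suc J) k n

  opaque
    unfolding φB-at φB-value

    φB-value-def : ∀ i J k n → φB-value i J k n ≡ φB i (suc J) k n
    φB-value-def i J k n = refl

    φB-value-other-degree : ∀ n′ j′ k′ J k n → ¬ n ≡ n′ → φB-value (n′ , j′ , k′) J k n ≡ 0ℚ
    φB-value-other-degree n′ j′ k′ J k n ne = trans (φB-lift n′ j′ k′ (suc J) k n) (cong (λ z → if z then φB-coeff n′ j′ k′ (suc J) k else 0ℚ) (≡ᵇ-false n n′ ne))

    φB-value-same-degree : ∀ n j′ k′ J k → φB-value (n , j′ , k′) J k n ≡ φB-at n j′ k′ J k
    φB-value-same-degree n j′ k′ J k = trans (φB-lift n j′ k′ (suc J) k n) (cong (λ z → if z then φB-coeff n j′ k′ (suc J) k else 0ℚ) (≡ᵇ-true n n refl))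

    φB-at-above : ∀ n j′ k′ J k → J < j′ → 1 ≤ n → φB-at n j′ k′ J k ≡ 0ℚ
    φB-at-above n j′ k′ J k J<j′ 1≤n with k′ ≤ᵇ k
    ... | false = refl
    ... | true = cong fromℕ (trans (sym (cnt-QB (J + n ∸ j′) n (k ∸ k′))) (cong (cnt (k ∸ k′)) (QB-small (J + n ∸ j′) n small)))
      where
      small : J + n ∸ j′ < n
      small = ℕP.≤-trans (s≤s (ℕP.∸-monoʳ-≤ (J + n) J<j′)) (ℕP.≤-reflexive (trans (cong suc (shift-∸ J n)) (sucpred n 1≤n)))

    qbin-top : ∀ n J a → qbin (J + n ∸ J) n a ≡ cnt a (0 ∷ [])
    qbin-top n J a = trans (cong (λ z → qbin z n a) (ℕP.m+n∸m≡n J n)) (trans (sym (cnt-QB n n a)) (cong (cnt a) (QB-diagonal n)))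

    φB-at-diagonal : ∀ n J k → φB-at n J k J k ≡ 1ℚ
    φB-at-diagonal n J k = trans (cong (λ z → if z then fromℕ (qbin (J + n ∸ J) n (k ∸ k)) else 0ℚ) (≤ᵇ-true k k ℕP.≤-refl))
                         (cong fromℕ (trans (qbin-top n J (k ∸ k)) (cong (λ z → cnt z (0 ∷ [])) (ℕP.n∸n≡0 k))))

    φB-at-off-diagonal : ∀ n J k k′ → ¬ k ≡ k′ → φB-at n J k′ J k ≡ 0ℚ
    φB-at-off-diagonal n J k k′ ne with k′ ℕP.≤? k
    ... | no nle = cong (λ z → if z then fromℕ (qbin (J + n ∸ J) n (k ∸ k′)) else 0ℚ) (≤ᵇ-false k′ k nle)
    ... | yes le = trans (cong (λ z → if z then fromℕ (qbin (J + n ∸ J) n (k ∸ k′)) else 0ℚ) (≤ᵇ-true k′ k le))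
                         (cong fromℕ (trans (qbin-top n J (k ∸ k′)) (pos (k ∸ k′) (λ e → ne (sym (ℕP.≤-antisym le (ℕP.m∸n≡0⇒m≤n e)))))))
      where
      pos : ∀ a → ¬ a ≡ 0 → cnt a (0 ∷ []) ≡ 0
      pos zero ne = ⊥-elim (ne refl)
      pos (suc a) _ = refl

  value-triangular : ∀ n J k n′ j′ k′ → Achieved (n′ , j′ , k′) →
    φB-value (n′ , j′ , k′) J k n ≡ (if j′ <ᵇ J then φB-value (n′ , j′ , k′) J k n else 0ℚ) ℚ.+ δI (n , J , k) (n′ , j′ , k′)
  value-triangular n J k n′ j′ k′ ach with ℕP.<-cmp j′ J
  ... | tri< j′<J _ _ = trans (sym (ℚP.+-identityʳ V)) (cong₂ ℚ._+_ (cong (λ z → if z then V else 0ℚ) (sym (<ᵇ-true j′ J j′<J)))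
          (sym (δI-ne (n , J , k) (n′ , j′ , k′) (λ e → ℕP.<-irrefl (cong desOf e) j′<J))))
    where V = φB-value (n′ , j′ , k′) J k n
  ... | tri> _ _ J<j′ = trans zeroV (sym (trans (cong (λ z → (if z then V else 0ℚ) ℚ.+ δI (n , J , k) (n′ , j′ , k′)) (<ᵇ-false j′ J (ℕP.<⇒≯ J<j′)))
          (trans (ℚP.+-identityˡ (δI (n , J , k) (n′ , j′ , k′))) (δI-ne (n , J , k) (n′ , j′ , k′) (λ e → ℕP.<-irrefl (sym (cong desOf e)) J<j′)))))
    where
    V : ℚ
    V = φB-value (n′ , j′ , k′) J k n
    n′pos : 1 ≤ n′
    n′pos = ℕP.n≢0⇒n>0 (λ n0 → ℕP.<⇒≢ (ℕP.<-≤-trans (s≤s z≤n) J<j′) (sym (Achieved-empty n′ j′ k′ ach n0)))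
    zeroV : V ≡ 0ℚ
    zeroV with n ℕP.≟ n′
    ... | no ne = φB-value-other-degree n′ j′ k′ J k n ne
    ... | yes refl = trans (φB-value-same-degree n j′ k′ J k) (φB-at-above n j′ k′ J k J<j′ n′pos)
  ... | tri≈ _ refl _ = trans eqV (sym (trans (cong (λ z → (if z then V else 0ℚ) ℚ.+ δI (n , J , k) (n′ , J , k′)) (<ᵇ-false J J (ℕP.<-irrefl refl)))
      (ℚP.+-identityˡ (δI (n , J , k) (n′ , J , k′)))))
    where
    V : ℚ
    V = φB-value (n′ , J , k′) J k n
    eqV : V ≡ δI (n , J , k) (n′ , J , k′)
    eqV with n ℕP.≟ n′
    ... | no ne = trans (φB-value-other-degree n′ J k′ J k n ne) (sym (δI-ne (n , J , k) (n′ , J , k′) (λ e → ne (sym (cong proj₁ e)))))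
    ... | yes refl with k ℕP.≟ k′
    ...   | yes refl = trans (φB-value-same-degree n J k J k) (trans (φB-at-diagonal n J k) (sym (δI-self (n , J , k))))
    ...   | no ne = trans (φB-value-same-degree n J k′ J k) (trans (φB-at-off-diagonal n J k k′ ne) (sym (δI-ne (n , J , k) (n , J , k′) (λ e → ne (sym (cong (proj₂ ∘ proj₂) e))))))

  VanishesBelow : List (ℚ × Idx) → ℕ → Set
  VanishesBelow l J = ∀ (h : Idx → ℚ) → weighted l (λ i → if desOf i <ᵇ J then h i else 0ℚ) ≡ 0ℚ

  coefficient-at-level : ∀ l → All (Achieved ∘ proj₂) l → IsRelation φB l → ∀ J → VanishesBelow l J → ∀ n k → weighted l (δI (n , J , k)) ≡ 0ℚ
  coefficient-at-level l ach lz J nb n k =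
    trans (sym (ℚP.+-identityˡ _)) (trans (cong (ℚ._+ weighted l (δI (n , J , k))) (sym (nb g)))
    (trans (sym (weighted-+ l (λ i → if desOf i <ᵇ J then g i else 0ℚ) (δI (n , J , k))))
    (trans (sym (weighted-cong l g _ (All.map (λ {ci} a → kk ci a) ach)))
    (trans (weighted-cong l g (λ i → φB i (suc J) k n) (All.tabulate (λ {ci} _ → φB-value-def (proj₂ ci) J k n)))
    (trans (sym (lincomb-eval φB l (suc J) k n)) (lz (suc J) k n))))))
    where
    g : Idx → ℚ
    g i = φB-value i J k n
    kk : ∀ ci → Achieved (proj₂ ci) → g (proj₂ ci) ≡ (if desOf (proj₂ ci) <ᵇ J then g (proj₂ ci) else 0ℚ) ℚ.+ δI (n , J , k) (proj₂ ci)
    kk (c , (n′ , j′ , k′)) a = value-triangular n J k n′ j′ k′ a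

  split-below-suc : ∀ j J x → (if j <ᵇ suc J then x else 0ℚ) ≡ (if j <ᵇ J then x else 0ℚ) ℚ.+ (if j ≡ᵇ J then x else 0ℚ)
  split-below-suc j J x with ℕP.<-cmp j J
  ... | tri< lt ne _ = trans (cong (λ z → if z then x else 0ℚ) (<ᵇ-true j (suc J) (ℕP.m<n⇒m<1+n lt)))
     (sym (trans (cong₂ (λ a b → (if a then x else 0ℚ) ℚ.+ (if b then x else 0ℚ)) (<ᵇ-true j J lt) (≡ᵇ-false j J ne)) (ℚP.+-identityʳ x)))
  ... | tri≈ _ refl _ = trans (cong (λ z → if z then x else 0ℚ) (<ᵇ-true j (suc j) (ℕP.n<1+n j)))
     (sym (trans (cong₂ (λ a b → (if a then x else 0ℚ) ℚ.+ (if b then x else 0ℚ)) (<ᵇ-false j j (ℕP.<-irrefl refl)) (≡ᵇ-true j j refl)) (ℚP.+-identityˡ x)))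
  ... | tri> _ ne gt = trans (cong (λ z → if z then x else 0ℚ) (<ᵇ-false j (suc J) (λ le → ℕP.<⇒≱ gt (ℕP.≤-pred le))))
     (sym (trans (cong₂ (λ a b → (if a then x else 0ℚ) ℚ.+ (if b then x else 0ℚ)) (<ᵇ-false j J (ℕP.<⇒≯ gt)) (≡ᵇ-false j J ne)) (ℚP.+-identityˡ 0ℚ)))

  vanishes-below : ∀ l → All (Achieved ∘ proj₂) l → IsRelation φB l → ∀ J → VanishesBelow l J
  vanishes-below l ach lz zero h = weighted-0 l
  vanishes-below l ach lz (suc J) h =
    trans (weighted-cong l _ (λ i → (if desOf i <ᵇ J then h i else 0ℚ) ℚ.+ (if desOf i ≡ᵇ J then h i else 0ℚ)) (All.tabulate (λ {ci} _ → split-below-suc (desOf (proj₂ ci)) J (h (proj₂ ci)))))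
    (trans (weighted-+ l _ _) (trans (cong₂ ℚ._+_ (vanishes-below l ach lz J h)
       (weighted-restrict (λ i → desOf i ≡ᵇ J) (length l) l ℕP.≤-refl hyp h)) (ℚP.+-identityˡ 0ℚ)))
    where
    hyp : ∀ i → (desOf i ≡ᵇ J) ≡ true → weighted l (δI i) ≡ 0ℚ
    hyp (n , j , k) e = subst (λ z → weighted l (δI (n , z , k)) ≡ 0ℚ) (sym (≡ᵇ-sound j J e)) (coefficient-at-level l ach lz J (vanishes-below l ach lz J) n k)

  φB-independent : ∀ l → All (Achieved ∘ proj₂) l → IsRelation φB l → ∀ i → weighted l (δI i) ≡ 0ℚ
  φB-independent l ach lz (n , j , k) = coefficient-at-level l ach lz j (vanishes-below l ach lz j) n k

module Spans (P : Idx → Set) (gen : Idx → E) where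

  open CoefficientArrays

  LC : List (ℚ × Idx) → E
  LC l = lincomb (map (λ ci → proj₁ ci , gen (proj₂ ci)) l)

  span-≈ : ∀ {f g} → f ≈ g → InSpan P gen g → InSpan P gen f
  span-≈ e (l , a , e′) = l , a , ≈-trans e e′

  span-0 : InSpan P gen 0E
  span-0 = [] , [] , ≈-refl

  LC-++ : ∀ l₁ l₂ → LC (l₁ ++ l₂) ≈ (LC l₁ ⊕ LC l₂)
  LC-++ [] l₂ m a b = sym (ℚP.+-identityˡ (LC l₂ m a b))
  LC-++ ((c , i) ∷ l₁) l₂ m a b = trans (cong (c ℚ.* gen i m a b ℚ.+_) (LC-++ l₁ l₂ m a b)) (sym (ℚP.+-assoc (c ℚ.* gen i m a b) (LC l₁ m a b) (LC l₂ m a b)))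

  span-⊕ : ∀ {f g} → InSpan P gen f → InSpan P gen g → InSpan P gen (f ⊕ g)
  span-⊕ (l₁ , a₁ , e₁) (l₂ , a₂ , e₂) = l₁ ++ l₂ , AllP.++⁺ a₁ a₂ ,
    λ m a b → trans (cong₂ ℚ._+_ (e₁ m a b) (e₂ m a b)) (sym (LC-++ l₁ l₂ m a b))

  scale : ℚ → List (ℚ × Idx) → List (ℚ × Idx)
  scale c = map (λ di → c ℚ.* proj₁ di , proj₂ di)

  LC-scale : ∀ c l → LC (scale c l) ≈ (c · LC l)
  LC-scale c [] m a b = sym (ℚP.*-zeroʳ c)
  LC-scale c ((d , i) ∷ l) m a b = trans (cong₂ ℚ._+_ (ℚP.*-assoc c d _) (LC-scale c l m a b)) (sym (ℚP.*-distribˡ-+ c _ _))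

  span-· : ∀ c {f} → InSpan P gen f → InSpan P gen (c · f)
  span-· c (l , a , e) = scale c l , AllP.map⁺ a , λ m x b → trans (cong (c ℚ.*_) (e m x b)) (sym (LC-scale c l m x b))

  span-gen : ∀ i → P i → InSpan P gen (gen i)
  span-gen i p = (1ℚ , i) ∷ [] , p ∷ [] , λ m a b → sym (trans (ℚP.+-identityʳ _) (ℚP.*-identityˡ _))

  span-sumE : ∀ {A : Set} (F : A → E) l → All (λ x → InSpan P gen (F x)) l → InSpan P gen (sumE (map F l))
  span-sumE F [] _ = span-0
  span-sumE F (x ∷ l) (s ∷ ss) = span-⊕ s (span-sumE F l ss)

  -- closure under ⊛ follows from bilinearity
  module _ (gen-⊛ : ∀ i j → P i → P j → InSpan P gen (gen i ⊛ gen j)) where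

    span-gen-⊛ : ∀ i → P i → ∀ l → All (P ∘ proj₂) l → InSpan P gen (gen i ⊛ LC l)
    span-gen-⊛ i p [] _ = span-≈ (⊛-zeroʳ (gen i)) span-0
    span-gen-⊛ i p ((c , j) ∷ l) (pj ∷ ps) = span-≈ (≈-trans (⊛-distribˡ (c · gen j) (LC l) (gen i)) (λ m a b → cong (ℚ._+ (gen i ⊛ LC l) m a b) (⊛-· c (gen j) (gen i) m a b)))
       (span-⊕ (span-· c (gen-⊛ i j p pj)) (span-gen-⊛ i p l ps))

    span-LC-⊛ : ∀ l₁ l₂ → All (P ∘ proj₂) l₁ → All (P ∘ proj₂) l₂ → InSpan P gen (LC l₁ ⊛ LC l₂)
    span-LC-⊛ [] l₂ _ _ = span-≈ (⊛-zeroˡ (LC l₂)) span-0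
    span-LC-⊛ ((c , i) ∷ l₁) l₂ (pi ∷ ps) ps₂ = span-≈ (≈-trans (⊛-distribʳ (c · gen i) (LC l₁) (LC l₂)) (λ m a b → cong (ℚ._+ (LC l₁ ⊛ LC l₂) m a b) (·-⊛ c (gen i) (LC l₂) m a b)))
       (span-⊕ (span-· c (span-gen-⊛ i pi l₂ ps₂)) (span-LC-⊛ l₁ l₂ ps ps₂))

    span-⊛ : ∀ f g → InSpan P gen f → InSpan P gen g → InSpan P gen (f ⊛ g)
    span-⊛ f g (l₁ , a₁ , e₁) (l₂ , a₂ , e₂) = span-≈ (⊛-cong e₁ e₂) (span-LC-⊛ l₁ l₂ a₁ a₂)

-- Any two classes have disjoint representatives: shift the letters of σ
-- above those of π; shifting preserves des and comaj.
module Relabelling where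

  open DescentComajRange using (des-map-suc; comaj-map-suc; ∈⇒≤sum)

  des-shift : ∀ K σ → des (map (K +_) σ) ≡ des σ
  des-shift zero σ = cong des (LP.map-id σ)
  des-shift (suc K) σ = trans (cong des (LP.map-∘ σ)) (trans (des-map-suc (map (K +_) σ)) (des-shift K σ))

  comaj-shift : ∀ K σ → comaj (map (K +_) σ) ≡ comaj σ
  comaj-shift zero σ = cong comaj (LP.map-id σ)
  comaj-shift (suc K) σ = trans (cong comaj (LP.map-∘ σ)) (trans (comaj-map-suc (map (K +_) σ)) (comaj-shift K σ))

  cls-shift : ∀ K σ → cls (map (K +_) σ) ≡ cls σ
  cls-shift K σ = cong₂ _,_ (LP.length-map (K +_) σ) (cong₂ _,_ (des-shift K σ) (comaj-shift K σ))

  relabel : ∀ π σ → IsPerm π → IsPerm σ → Σ (List ℕ) λ σ′ → IsPerm σ′ × Disjoint π σ′ × cls σ′ ≡ cls σ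
  relabel π σ pπ (uσ , posσ) = map (K +_) σ ,
    (AllPairsP.map⁺ (AllPairs.map (λ ne e → ne (ℕP.+-cancelˡ-≡ K _ _ e)) uσ) , AllP.map⁺ (All.map (λ {z} 0<z → ℕP.<-≤-trans 0<z (ℕP.m≤n+m z K)) posσ)) ,
    All.tabulate (λ {x} mx my → above x mx my) , cls-shift K σ
    where
    K : ℕ
    K = sum π
    above : ∀ x → x ∈ π → x ∈ map (K +_) σ → ⊥
    above x mx my with MP.∈-map⁻ (K +_) my
    ... | z , mz , refl = ℕP.<-irrefl {K} refl (ℕP.≤-trans (ℕP.≤-reflexive (ℕP.+-comm 1 K)) (ℕP.≤-trans (ℕP.+-monoʳ-≤ K (All.lookup posσ mz)) (∈⇒≤sum π mx)))

  Achieved-cls : ∀ i → (a : Achieved i) → cls (proj₁ a) ≡ i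
  Achieved-cls (n , d , c) (π , _ , refl , refl , refl) = refl

module IsomorphismCriterion where

  open CoefficientArrays
  open DescentComajRange using (Achieved⇒Target; Target⇒Achieved)
  open FormalCombinations using (weighted; δI; coefficients-vanish; IsRelation)
  open ShuffleSets using (shuffle-isPerm)
  open Relabelling using (relabel; Achieved-cls)

  Multiplicative : (Idx → E) → Set
  Multiplicative φ = ∀ π σ → IsPerm π → IsPerm σ → Disjoint π σ → (φ (cls π) ⊛ φ (cls σ)) ≈ sumE (map (φ ∘ cls) (shuffles π σ))

  Independent : (Idx → E) → Set
  Independent φ = ∀ l → All (Achieved ∘ proj₂) l → IsRelation φ l → ∀ i → weighted l (δI i) ≡ 0ℚ

  -- unit, multiplicativity and injectivity are given; the image is the span
  -- of gen because gen agrees with φ on Target = classes; the span is closed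
  -- under ⊛ because a product of generators is a sum over a shuffle set.
  isomorphism : ∀ (φ gen : Idx → E) (one : E) → φ (0 , 0 , 0) ≈ one → Multiplicative φ → Independent φ →
    (∀ i → Target i → gen i ≈ φ i) → IsAlgIsoOnto one φ gen
  isomorphism φ gen one unit mult indep agree =
    unit , mult , (λ l ach distinct rel → coefficients-vanish l (indep l ach rel) distinct) ,
    image⊆span , span⊆image , one-in-span , span-⊛ gen-⊛
    where
    open Spans Target gen
    image⊆span : ∀ i → Achieved i → InSpan Target gen (φ i)
    image⊆span i a = span-≈ (≈-sym (agree i (Achieved⇒Target i a))) (span-gen i (Achieved⇒Target i a))
    span⊆image : ∀ i → Target i → InSpan Achieved φ (gen i)
    span⊆image i t = Spans.span-≈ Achieved φ (agree i t) (Spans.span-gen Achieved φ i (Target⇒Achieved i t))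
    t₀ : Target (0 , 0 , 0)
    t₀ = inj₁ (refl , refl , refl)
    one-in-span : InSpan Target gen one
    one-in-span = span-≈ (≈-trans (≈-sym unit) (≈-sym (agree (0 , 0 , 0) t₀))) (span-gen (0 , 0 , 0) t₀)
    gen-⊛ : ∀ i j → Target i → Target j → InSpan Target gen (gen i ⊛ gen j)
    gen-⊛ i j ti tj with Target⇒Achieved i ti | Target⇒Achieved j tj
    ... | a@(π , pπ , _) | b@(σ , pσ , _) with relabel π σ pπ pσ
    ...   | σ′ , pσ′ , d , eσ = span-≈ (⊛-cong (agree i ti) (agree j tj))
            (span-≈ (subst₂ (λ x y → (φ i ⊛ φ j) ≈ (φ x ⊛ φ y)) (sym (Achieved-cls i a)) (sym (trans eσ (Achieved-cls j b))) ≈-refl)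
            (span-≈ (mult π σ′ pπ pσ′ d)
            (span-sumE (φ ∘ cls) (shuffles π σ′) (All.tabulate (λ {τ} m → image⊆span (cls τ) (τ , shuffle-isPerm π σ′ pπ pσ′ d m , refl , refl , refl))))))

module MultisetCounts {A : Set} (_≟_ : DecidableEquality A) where

  count : A → List A → ℕ
  count i [] = 0
  count i (x ∷ T) = (if ⌊ x ≟ i ⌋ then 1 else 0) + count i T

  count-++ : ∀ i T U → count i (T ++ U) ≡ count i T + count i U
  count-++ i [] U = refl
  count-++ i (x ∷ T) U = trans (cong ((if ⌊ x ≟ i ⌋ then 1 else 0) +_) (count-++ i T U)) (sym (ℕP.+-assoc (if ⌊ x ≟ i ⌋ then 1 else 0) _ _))

  count-self : ∀ x T → count x (x ∷ T) ≡ suc (count x T)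
  count-self x T with x ≟ x
  ... | yes _ = refl
  ... | no ne = ⊥-elim (ne refl)

  count-pos : ∀ x T → 1 ≤ count x T → x ∈ T
  count-pos x (y ∷ T) le with y ≟ x
  ... | yes refl = here refl
  ... | no _ = there (count-pos x T le)

  counts⇒↭ : ∀ T T′ → (∀ i → count i T ≡ count i T′) → T ↭ T′
  counts⇒↭ [] [] h = ↭-refl
  counts⇒↭ [] (x ∷ T′) h = ⊥-elim (ℕP.0≢1+n (trans (h x) (count-self x T′)))
  counts⇒↭ (x ∷ T) T′ h with MP.∈-∃++ (count-pos x T′ (subst (1 ≤_) (trans (sym (count-self x T)) (h x)) (s≤s z≤n)))
  ... | U , V , refl = ↭-trans (prep x (counts⇒↭ T (U ++ V) rest)) (↭-sym (PP.shift x U V))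
    where
    -- removing one copy of x from both sides
    rest : ∀ i → count i T ≡ count i (U ++ V)
    rest i = ℕP.+-cancelˡ-≡ (if ⌊ x ≟ i ⌋ then 1 else 0) _ _ (trans (h i)
       (trans (count-++ i U (x ∷ V)) (trans (ℕP.+-comm (count i U) _) (trans (ℕP.+-assoc (if ⌊ x ≟ i ⌋ then 1 else 0) (count i V) (count i U))
       (cong ((if ⌊ x ≟ i ⌋ then 1 else 0) +_) (trans (ℕP.+-comm (count i V) (count i U)) (sym (count-++ i U V))))))))

-- (a): since φB is multiplicative, the multiset of classes of S(π, σ) is
-- determined by φB[π] φB[σ]; since φB is independent, the multiset of
-- classes is determined by the sum of its φB-images.
module PartA where

  open ℚ-Solver using (solve; _:+_; _:*_; _:=_; con; :-_)
  open NatToRational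
  open CoefficientArrays
  open ModelB using (φB-multiplicative)
  open Independence using (φB-independent)
  open FormalCombinations using (lincomb-eval; weighted; weighted-++; δI; _≟I_; IsRelation)
  open ShuffleSets using (shuffle-isPerm)
  open MultisetCounts _≟I_

  wt : ℚ → List Idx → List (ℚ × Idx)
  wt c = map (λ i → c , i)

  weighted-wt-δ : ∀ c i T → weighted (wt c T) (δI i) ≡ c ℚ.* fromℕ (count i T)
  weighted-wt-δ c i [] = sym (ℚP.*-zeroʳ c)
  weighted-wt-δ c i (x ∷ T) = trans (cong (c ℚ.* δI i x ℚ.+_) (weighted-wt-δ c i T))
    (trans (sym (ℚP.*-distribˡ-+ c (δI i x) (fromℕ (count i T)))) (cong (c ℚ.*_) (sym (trans (fromℕ-+ (if ⌊ x ≟I i ⌋ then 1 else 0) (count i T)) (cong (ℚ._+ fromℕ (count i T)) (fromℕ-if ⌊ x ≟I i ⌋))))))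

  weighted-wt : ∀ c (φ : Idx → E) T m a b → weighted (wt c T) (λ i → φ i m a b) ≡ c ℚ.* sumE (map φ T) m a b
  weighted-wt c φ [] m a b = sym (ℚP.*-zeroʳ c)
  weighted-wt c φ (i ∷ T) m a b = trans (cong (c ℚ.* φ i m a b ℚ.+_) (weighted-wt c φ T m a b)) (sym (ℚP.*-distribˡ-+ c _ _))

  -- multisets of classes with the same φB-sum are equal: T - T′ is a
  -- relation, so the multiplicities agree
  φB-sum-injective : ∀ T T′ → All Achieved T → All Achieved T′ → sumE (map φB T) ≈ sumE (map φB T′) → T ↭ T′
  φB-sum-injective T T′ aT aT′ same = counts⇒↭ T T′ same-count
    where
    l : List (ℚ × Idx)
    l = wt 1ℚ T ++ wt (ℚ.- 1ℚ) T′
    rel : IsRelation φB l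
    rel m a b = trans (lincomb-eval φB l m a b) (trans (weighted-++ (wt 1ℚ T) (wt (ℚ.- 1ℚ) T′) _)
      (trans (cong₂ ℚ._+_ (weighted-wt 1ℚ φB T m a b) (weighted-wt (ℚ.- 1ℚ) φB T′ m a b))
      (trans (cong (λ z → 1ℚ ℚ.* sumE (map φB T) m a b ℚ.+ (ℚ.- 1ℚ) ℚ.* z) (sym (same m a b)))
      (solve 1 (λ x → con 1ℚ :* x :+ (:- con 1ℚ) :* x := con 0ℚ) refl (sumE (map φB T) m a b)))))
    same-count : ∀ i → count i T ≡ count i T′
    same-count i = fromℕ-inj _ _ (trans (solve 2 (λ x y → x := (con 1ℚ :* x :+ (:- con 1ℚ) :* y) :+ y) refl x y)
       (trans (cong (ℚ._+ y) difference) (ℚP.+-identityˡ y)))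
      where
      x y : ℚ
      x = fromℕ (count i T)
      y = fromℕ (count i T′)
      difference : 1ℚ ℚ.* x ℚ.+ (ℚ.- 1ℚ) ℚ.* y ≡ 0ℚ
      difference = trans (sym (cong₂ ℚ._+_ (weighted-wt-δ 1ℚ i T) (weighted-wt-δ (ℚ.- 1ℚ) i T′)))
        (trans (sym (weighted-++ (wt 1ℚ T) (wt (ℚ.- 1ℚ) T′) (δI i))) (φB-independent l (AllP.++⁺ (AllP.map⁺ aT) (AllP.map⁺ aT′)) rel i))

  shuffle-classes : ∀ π σ → IsPerm π → IsPerm σ → Disjoint π σ → All Achieved (map cls (shuffles π σ))
  shuffle-classes π σ pπ pσ d = AllP.map⁺ (All.tabulate (λ {τ} m → τ , shuffle-isPerm π σ pπ pσ d m , refl , refl , refl))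

  shuffle-sum : ∀ π σ → sumE (map (φB ∘ cls) (shuffles π σ)) ≈ sumE (map φB (map cls (shuffles π σ)))
  shuffle-sum π σ m a b = cong (λ l → sumE l m a b) (LP.map-∘ (shuffles π σ))

  shuffleCompatible : ShuffleCompatible
  shuffleCompatible π σ π′ σ′ pπ pσ pπ′ pσ′ d d′ lπ lσ sπ sσ =
    ↭-trans (↭-reflexive (LP.map-∘ (shuffles π σ)))
    (↭-trans (PP.map⁺ proj₂ (φB-sum-injective _ _ (shuffle-classes π σ pπ pσ d) (shuffle-classes π′ σ′ pπ′ pσ′ d′) same-sum))
    (↭-reflexive (sym (LP.map-∘ (shuffles π′ σ′)))))
    where
    same-classes : (φB (cls π) ⊛ φB (cls σ)) ≈ (φB (cls π′) ⊛ φB (cls σ′))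
    same-classes = subst₂ (λ x y → (φB (cls π) ⊛ φB (cls σ)) ≈ (φB x ⊛ φB y)) (cong₂ _,_ lπ sπ) (cong₂ _,_ lσ sσ) ≈-refl
    same-sum : sumE (map φB (map cls (shuffles π σ))) ≈ sumE (map φB (map cls (shuffles π′ σ′)))
    same-sum = ≈-trans (≈-sym (shuffle-sum π σ)) (≈-trans (≈-sym (φB-multiplicative π σ pπ pσ d))
               (≈-trans same-classes (≈-trans (φB-multiplicative π′ σ′ pπ′ pσ′ d′) (shuffle-sum π′ σ′))))

module PartB where

  open NatToRational
  open CoefficientArrays
  open GaussianMultisets using (qbin-0)
  open ModelB
  open Independence using (φB-independent)
  open IsomorphismCriterion using (isomorphism)

  unitB : φB (0 , 0 , 0) ≈ oneB
  unitB = ≈-trans (φB-lift 0 0 0) (≈-trans (liftX-cong 0 (λ p a → trans (cong fromℕ (qbin-0 (p + 0 ∸ 1 ∸ 0) a)) (fromℕ-if (a ≡ᵇ 0)))) (≈-sym (monoB-X 0 0)))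

  genB≈φB : ∀ i → Target i → genB i ≈ φB i
  genB≈φB (zero , .0 , .0) (inj₁ (refl , refl , refl)) = ≈-sym unitB
  genB≈φB (zero , j , k) (inj₂ (() , _))
  genB≈φB (suc n , j , k) t = ≈-refl

  isoB : IsAlgIsoOnto oneB φB genB
  isoB = isomorphism φB genB oneB unitB φB-multiplicative φB-independent genB≈φB

-- The coefficient of t^M q^A in 1/((1-t)(1-qt)...(1-q^N t)) is
-- binom(M + N, N)_q; hence the coefficient of t^m in φC is φB at p = m.
module GeometricSeries where

  open NatToRational
  open FiniteSums
  open CoefficientArrays
  open BooleanTests
  open GaussianMultisets
  open ModelB using (φB-coeff; qbin-arg; qbin-small)

  cnt-concatMap : ∀ {A : Set} a (F : A → List ℕ) l → fromℕ (cnt a (concatMap F l)) ≡ foldr ℚ._+_ 0ℚ (map (λ r → fromℕ (cnt a (F r))) l)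
  cnt-concatMap a F [] = refl
  cnt-concatMap a F (x ∷ l) = trans (cong fromℕ (cnt-++ a (F x) (concatMap F l))) (trans (fromℕ-+ (cnt a (F x)) (cnt a (concatMap F l))) (cong (fromℕ (cnt a (F x)) ℚ.+_) (cnt-concatMap a F l)))

  Σ-complement : ∀ A K (F : ℕ → ℚ) → Σ≤ A (λ j → F j ℚ.* (if A ∸ j ≡ᵇ K then 1ℚ else 0ℚ)) ≡ (if K ≤ᵇ A then F (A ∸ K) else 0ℚ)
  Σ-complement A K F with K ℕP.≤? A
  ... | yes K≤A = trans (Σ-single A (A ∸ K) _ (ℕP.m∸n≤m A K) (λ j j≤A j≢ → trans (cong (F j ℚ.*_) (if-false (≡ᵇ-false (A ∸ j) K (λ e → j≢ (trans (sym (ℕP.m∸[m∸n]≡n j≤A)) (cong (A ∸_) e)))))) (ℚP.*-zeroʳ (F j))))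
     (trans (cong (F (A ∸ K) ℚ.*_) (if-true (≡ᵇ-true (A ∸ (A ∸ K)) K (ℕP.m∸[m∸n]≡n K≤A)))) (trans (ℚP.*-identityʳ _) (sym (if-true (≤ᵇ-true K A K≤A)))))
  ... | no K≰A = trans (Σ-0 A _ (λ j _ → trans (cong (F j ℚ.*_) (if-false (≡ᵇ-false (A ∸ j) K (λ e → K≰A (subst (_≤ A) e (ℕP.m∸n≤m A j)))))) (ℚP.*-zeroʳ (F j))))
     (sym (if-false (≤ᵇ-false K A K≰A)))

  -- induction on N: multiply by 1/(1 - q^(N+1) t) and use the hockey stick
  prodGeom-coeff : ∀ N M A → prodGeom N M A ≡ fromℕ (qbin (M + N) N A)
  prodGeom-coeff zero M A = sym (trans (cong fromℕ (qbin-0 (M + 0) A)) (fromℕ-if (A ≡ᵇ 0)))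
  prodGeom-coeff (suc N) M A =
    trans (Σ-cong M (λ i _ → Σ-complement A (suc N ℕ.* (M ∸ i)) (prodGeom N i)))
    (trans (Σ-rev M F)
    (trans (Σ-cong M (λ r r≤M → trans (cong (λ z → if suc N ℕ.* z ≤ᵇ A then prodGeom N (M ∸ r) (A ∸ suc N ℕ.* z) else 0ℚ) (ℕP.m∸[m∸n]≡n r≤M))
                                      (cong (λ z → if suc N ℕ.* r ≤ᵇ A then z else 0ℚ) (prodGeom-coeff N (M ∸ r) (A ∸ suc N ℕ.* r)))))
    (sym (trans (cong fromℕ (trans (sym (cnt-QB (M + suc N) (suc N) A)) (trans (cong (λ z → cnt A (QB z (suc N))) (ℕP.+-suc M N))
                    (cnt-↭ A (hockey (suc M) N)))))
         (trans (cnt-concatMap A T (upTo (suc M))) (Σ-cong M (λ r _ → trans (cong fromℕ (cnt-shift (suc N ℕ.* r) A (QB ((M ∸ r) + N) N))) (shifted (suc N ℕ.* r ≤ᵇ A) r))))))))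
    where
    F : ℕ → ℚ
    F i = if suc N ℕ.* (M ∸ i) ≤ᵇ A then prodGeom N i (A ∸ suc N ℕ.* (M ∸ i)) else 0ℚ
    T : ℕ → List ℕ
    T r = map ((suc N ℕ.* r) +_) (QB ((suc M ∸ suc r) + N) N)
    shifted : ∀ b r → fromℕ (if b then cnt (A ∸ suc N ℕ.* r) (QB ((suc M ∸ suc r) + N) N) else 0)
                 ≡ (if b then fromℕ (qbin ((M ∸ r) + N) N (A ∸ suc N ℕ.* r)) else 0ℚ)
    shifted true r = cong fromℕ (cnt-QB ((M ∸ r) + N) N (A ∸ suc N ℕ.* r))
    shifted false r = refl

  Σ-indicator : ∀ m D (X : ℕ → ℚ) → Σ≤ m (λ i → if i ≡ᵇ D then X i else 0ℚ) ≡ (if D ≤ᵇ m then X D else 0ℚ)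
  Σ-indicator m D X with D ℕP.≤? m
  ... | yes D≤m = trans (Σ-single m D _ D≤m (λ i _ i≢ → if-false (≡ᵇ-false i D i≢)))
     (trans (if-true (≡ᵇ-true D D refl)) (sym (if-true (≤ᵇ-true D m D≤m))))
  ... | no D≰m = trans (Σ-0 m _ (λ i i≤m → if-false (≡ᵇ-false i D (λ e → D≰m (subst (_≤ m) e i≤m)))))
     (sym (if-false (≤ᵇ-false D m D≰m)))

  monoS-⊙ : ∀ D c (f : S2) m a → (monoS D c ⊙ f) m a ≡ (if D ≤ᵇ m then (if c ≤ᵇ a then f (m ∸ D) (a ∸ c) else 0ℚ) else 0ℚ)
  monoS-⊙ D c f m a = trans (Σ-cong m (λ i _ → inner i)) (Σ-indicator m D (λ i → if c ≤ᵇ a then f (m ∸ i) (a ∸ c) else 0ℚ))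
    where
    inner : ∀ i → Σ≤ a (λ j → monoS D c i j ℚ.* f (m ∸ i) (a ∸ j)) ≡ (if i ≡ᵇ D then (if c ≤ᵇ a then f (m ∸ i) (a ∸ c) else 0ℚ) else 0ℚ)
    inner i with i ≡ᵇ D
    ... | true = δ⋆ c (λ _ j → f (m ∸ i) j) m a
    ... | false = Σ-0 a _ (λ j _ → ℚP.*-zeroˡ (f (m ∸ i) (a ∸ j)))

  φC-coeff : ∀ n d c → (monoS (suc d) c ⊙ prodGeom (suc n)) ≈S φB-coeff (suc n) d c
  φC-coeff n d c m a = trans (monoS-⊙ (suc d) c (prodGeom (suc n)) m a) (by-cases (suc d ℕP.≤? m))
    where
    by-cases : Dec (suc d ≤ m) → (if suc d ≤ᵇ m then (if c ≤ᵇ a then prodGeom (suc n) (m ∸ suc d) (a ∸ c) else 0ℚ) else 0ℚ) ≡ φB-coeff (suc n) d c m a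
    by-cases (yes le) rewrite ≤ᵇ-true (suc d) m le with c ≤ᵇ a
    ... | false = refl
    ... | true = trans (prodGeom-coeff (suc n) (m ∸ suc d) (a ∸ c)) (cong fromℕ (trans (cong (λ z → qbin z (suc n) (a ∸ c)) e) (sym (qbin-arg m n d (a ∸ c)))))
      where
      e : (m ∸ suc d) + suc n ≡ (m ∸ d) + n
      e = trans (ℕP.+-suc (m ∸ suc d) n) (cong (_+ n) (sym (ℕP.+-∸-assoc 1 le)))
    by-cases (no nle) rewrite ≤ᵇ-false (suc d) m nle with c ≤ᵇ a
    ... | false = refl
    ... | true = sym (trans (cong fromℕ (qbin-arg m n d (a ∸ c))) (cong fromℕ (trans (cong (λ z → qbin (z + n) (suc n) (a ∸ c)) (ℕP.m≤n⇒m∸n≡0 (ℕP.≤-pred (ℕP.≰⇒> nle))))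
         (qbin-small n (suc n) (a ∸ c) ℕP.≤-refl))))

-- (c): φC agrees with φB on all classes, so it inherits unit,
-- multiplicativity and independence from φB.
module PartC where

  open CoefficientArrays
  open ModelB using (φB-lift; φB-multiplicative)
  open GeometricSeries using (φC-coeff)
  open PartB using (unitB)
  open DescentComajRange using (Achieved⇒Target)
  open Independence using (φB-independent)
  open FormalCombinations using (lincomb-eval; weighted-cong)
  open IsomorphismCriterion using (isomorphism; Multiplicative; Independent)
  open ShuffleSets using (shuffle-isPerm)

  φC≈φB : ∀ i → Achieved i → φC i ≈ φB i
  φC≈φB (zero , d , c) a with Achieved⇒Target _ a
  ... | inj₁ (_ , refl , refl) = ≈-trans (liftX-cong 0 (λ m a → refl)) (≈-trans (≈-sym (monoB-X 0 0)) (≈-sym unitB))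
  ... | inj₂ (() , _)
  φC≈φB (suc n , d , c) a = ≈-trans (liftX-cong (suc n) (φC-coeff n d c)) (≈-sym (φB-lift (suc n) d c))

  φC-multiplicative : Multiplicative φC
  φC-multiplicative π σ pπ pσ d = ≈-trans (⊛-cong (φC≈φB (cls π) (π , pπ , refl , refl , refl)) (φC≈φB (cls σ) (σ , pσ , refl , refl , refl)))
    (≈-trans (φB-multiplicative π σ pπ pσ d) (sumE-cong (φB ∘ cls) (φC ∘ cls) (shuffles π σ) (All.tabulate (λ {τ} m → ≈-sym (φC≈φB (cls τ) (τ , shuffle-isPerm π σ pπ pσ d m , refl , refl , refl))))))

  φC-independent : Independent φC
  φC-independent l ach rel = φB-independent l ach (λ m a b → trans (lincomb-eval φB l m a b) (trans (weighted-cong l _ _ (All.map (λ {ci} ac → sym (φC≈φB (proj₂ ci) ac m a b)) ach))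
     (trans (sym (lincomb-eval φC l m a b)) (rel m a b))))

  isoC : IsAlgIsoOnto oneC φC genC
  isoC = isomorphism φC genC oneC ≈-refl φC-multiplicative φC-independent (λ i _ → ≈-refl)

-- (d): the classes of length n ≥ 1 are listed without repetition by
-- classList n, which has one block for each d < n consisting of the width n d
-- values C(d+1,2) ≤ k ≤ nd - C(d+1,2); the block sizes add up to C(n,3) + n.
module PartD where

  open DescentComajRange using (tri; tri-double; Target⇒InRange; InRange⇒Target; Achieved⇒Target; Target⇒Achieved)
  open ShuffleSets using (∈-concatMap⁺; ∈-concatMap⁻)

  width : ℕ → ℕ → ℕ
  width n d = suc (n ℕ.* d ∸ tri d ∸ tri d)

  block : ℕ → ℕ → List (ℕ × ℕ)
  block n d = map (λ c → d , tri d + c) (upTo (width n d))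

  classList : ℕ → List (ℕ × ℕ)
  classList n = concatMap (block n) (upTo n)

  unique-block : ∀ n d → Unique (block n d)
  unique-block n d = UP.map⁺ (λ e → ℕP.+-cancelˡ-≡ (tri d) _ _ (proj₂ (ProdP.,-injective e))) (UP.upTo⁺ (width n d))

  unique-blocks : ∀ n ds → Unique ds → Unique (concatMap (block n) ds)
  unique-blocks n [] _ = []
  unique-blocks n (d ∷ ds) (ad ∷ ud) = UP.++⁺ (unique-block n d) (unique-blocks n ds ud) dis
    where
    -- distinct blocks have distinct first components
    dis : ∀ {v} → (v ∈ block n d × v ∈ concatMap (block n) ds) → ⊥
    dis (m1 , m2) with MP.∈-map⁻ _ m1 | ∈-concatMap⁻ (block n) ds m2
    ... | c , _ , refl | d′ , md′ , mb with MP.∈-map⁻ _ mb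
    ...   | c′ , _ , e = All.lookup ad md′ (cong proj₁ e)

  Σ< : (ℕ → ℕ) → ℕ → ℕ
  Σ< f zero = 0
  Σ< f (suc n) = Σ< f n + f n

  sum-Σ< : ∀ f n → sum (map f (upTo n)) ≡ Σ< f n
  sum-Σ< f zero = refl
  sum-Σ< f (suc n) = trans (cong (sum ∘ map f) (sym (LP.upTo-∷ʳ n))) (trans (cong sum (LP.map-++ f (upTo n) (n ∷ [])))
     (trans (SumP.sum-++ (map f (upTo n)) (f n ∷ [])) (cong₂ _+_ (sum-Σ< f n) (ℕP.+-identityʳ (f n)))))

  length-concatMap : ∀ {A B : Set} (f : A → List B) l → length (concatMap f l) ≡ sum (map (length ∘ f) l)
  length-concatMap f [] = refl
  length-concatMap f (x ∷ l) = trans (LP.length-++ (f x)) (cong (length (f x) +_) (length-concatMap f l))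

  Σ<-cong : ∀ f g n → (∀ d → d < n → f d ≡ g d) → Σ< f n ≡ Σ< g n
  Σ<-cong f g zero h = refl
  Σ<-cong f g (suc n) h = cong₂ _+_ (Σ<-cong f g n (λ d d<n → h d (ℕP.m<n⇒m<1+n d<n))) (h n ℕP.≤-refl)

  Σ<-+ : ∀ f g n → Σ< (λ d → f d + g d) n ≡ Σ< f n + Σ< g n
  Σ<-+ f g zero = refl
  Σ<-+ f g (suc n) rewrite Σ<-+ f g n = lem (Σ< f n) (Σ< g n) (f n) (g n)
    where
    lem : ∀ a b c d → a + b + (c + d) ≡ a + c + (b + d)
    lem a b c d = trans (ℕP.+-assoc a b (c + d)) (trans (cong (a +_) (trans (sym (ℕP.+-assoc b c d)) (trans (cong (_+ d) (ℕP.+-comm b c)) (ℕP.+-assoc c b d)))) (sym (ℕP.+-assoc a c (b + d))))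

  Σ<-id : ∀ n → Σ< (λ d → d) n ≡ n C 2
  Σ<-id zero = refl
  Σ<-id (suc n) = trans (cong (_+ n) (Σ<-id n)) (trans (ℕP.+-comm (n C 2) n) (trans (cong (_+ n C 2) (sym (nC1≡n n))) (nCk+nC[k+1]≡[n+1]C[k+1] n 1)))

  tri-bound : ∀ n d → d < n → tri d + tri d ≤ n ℕ.* d
  tri-bound n d d<n = ℕP.≤-trans (ℕP.≤-reflexive (tri-double d)) (ℕP.≤-trans (ℕP.*-monoʳ-≤ d d<n) (ℕP.≤-reflexive (ℕP.*-comm d n)))

  width-suc : ∀ n d → d < n → width (suc n) d ≡ width n d + d
  width-suc n d d<n = cong suc (trans (ℕP.∸-+-assoc (d + n ℕ.* d) (tri d) (tri d))
     (trans (ℕP.+-∸-assoc d (tri-bound n d d<n)) (trans (ℕP.+-comm d _) (cong (_+ d) (sym (ℕP.∸-+-assoc (n ℕ.* d) (tri d) (tri d)))))))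

  width-last : ∀ n → width (suc n) n ≡ 1
  width-last n = cong suc (trans (ℕP.∸-+-assoc (suc n ℕ.* n) (tri n) (tri n)) (trans (cong (suc n ℕ.* n ∸_) (trans (tri-double n) (ℕP.*-comm n (suc n)))) (ℕP.n∸n≡0 (suc n ℕ.* n))))

  -- width (n+1) d = width n d + d for d < n, and width (n+1) n = 1
  Σ<-width : ∀ n → Σ< (width n) n ≡ n C 3 + n
  Σ<-width zero = refl
  Σ<-width (suc n) = trans (cong₂ _+_ (trans (Σ<-cong (width (suc n)) (λ d → width n d + d) n (width-suc n)) (trans (Σ<-+ (width n) (λ d → d) n) (cong₂ _+_ (Σ<-width n) (Σ<-id n)))) (width-last n))
    (trans (lem (n C 3) n (n C 2)) (cong (_+ suc n) (trans (ℕP.+-comm (n C 3) (n C 2)) (nCk+nC[k+1]≡[n+1]C[k+1] n 2))))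
    where
    lem : ∀ a b c → a + b + c + 1 ≡ a + c + suc b
    lem a b c = trans (ℕP.+-assoc (a + b) c 1) (trans (ℕP.+-assoc a b (c + 1)) (trans (cong (a +_) (trans (ℕP.+-comm b (c + 1)) (trans (ℕP.+-assoc c 1 b) refl))) (sym (ℕP.+-assoc a c (suc b)))))

  length-classList : ∀ n → length (classList n) ≡ n C 3 + n
  length-classList n = trans (length-concatMap (block n) (upTo n)) (trans (cong sum (LP.map-cong (λ d → trans (LP.length-map _ (upTo (width n d))) (LP.length-upTo (width n d))) (upTo n)))
    (trans (sum-Σ< (width n) n) (Σ<-width n)))

  classList⇒Target : ∀ n d c → (d , c) ∈ classList (suc n) → Target (suc n , d , c)
  classList⇒Target n d c m with ∈-concatMap⁻ (block (suc n)) (upTo (suc n)) m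
  ... | d′ , md′ , mb with MP.∈-map⁻ _ mb
  ...   | c′ , mc′ , refl = InRange⇒Target n d′ (tri d′ + c′) (MP.∈-upTo⁻ md′ , ℕP.m≤m+n (tri d′) c′ ,
          ℕP.≤-trans (ℕP.≤-reflexive (e (tri d′) c′)) (ℕP.≤-trans (ℕP.+-monoʳ-≤ (tri d′ + tri d′) (ℕP.≤-pred (MP.∈-upTo⁻ mc′)))
            (ℕP.≤-reflexive (trans (cong (tri d′ + tri d′ +_) (ℕP.∸-+-assoc (suc n ℕ.* d′) (tri d′) (tri d′))) (ℕP.m+[n∸m]≡n (tri-bound (suc n) d′ (MP.∈-upTo⁻ md′)))))))
    where
    e : ∀ t c → t + c + t ≡ t + t + c
    e t c = trans (ℕP.+-assoc t c t) (trans (cong (t +_) (ℕP.+-comm c t)) (sym (ℕP.+-assoc t t c)))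

  Target⇒classList : ∀ n d c → Target (suc n , d , c) → (d , c) ∈ classList (suc n)
  Target⇒classList n d c t with Target⇒InRange n d c t
  ... | (a , b , k) = ∈-concatMap⁺ (block (suc n)) (MP.∈-upTo⁺ a) (subst (λ z → (d , z) ∈ block (suc n) d) (ℕP.m+[n∸m]≡n b)
        (MP.∈-map⁺ (λ c → d , tri d + c) (MP.∈-upTo⁺ (s≤s lt))))
    where
    lt : c ∸ tri d ≤ suc n ℕ.* d ∸ tri d ∸ tri d
    lt = ℕP.m+n≤o⇒m≤o∸n (c ∸ tri d) (ℕP.m+n≤o⇒m≤o∸n (c ∸ tri d + tri d) (subst (_≤ suc n ℕ.* d) (cong (_+ tri d) (sym (ℕP.m∸n+n≡m b))) k))

  dimension : ∀ n → 1 ≤ n → DimComponent n (n C 3 + n)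
  dimension (suc n) _ = classList (suc n) , unique-blocks (suc n) (upTo (suc n)) (UP.upTo⁺ (suc n)) , length-classList (suc n) ,
    λ d c → mk⇔ (λ m → Target⇒Achieved _ (classList⇒Target n d c m)) (λ a → Target⇒classList n d c (Achieved⇒Target _ a))


open PartA using (shuffleCompatible)
open PartB using (isoB)
open PartC using (isoC)
open PartD using (dimension)

theorem4p5 : ShuffleCompatible
    × IsAlgIsoOnto oneB φB genB
    × IsAlgIsoOnto oneC φC genC
    × (∀ (n : ℕ) → 1 ≤ n → DimComponent n ((n C 3) + n))
theorem4p5 = shuffleCompatible , isoB , isoC , dimension
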